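{- For every prime $p$: (i) $\{(r,e,d)\in\mathscr{U}(p): p\mid r,\ \det M_d((x^r-x-1)^e)\ne0\}=\{(r,e,d)\in\mathscr{B}(p): p\mid r\}$; (ii) $\{(r,e,d)\in\mathscr{U}(p): p<r,\ p\nmid r,\ \det M_d((x^r-1)^e)\ne0\}=\{(r,e,d)\in\mathscr{B}(p): p<r,\ p\nmid r\}$; (iii) $\{(r,e,d)\in\mathscr{U}(p): 2\le r\le p-1,\ r\nmid p-1,\ \det M_d((x^r-1)^e)\ne0\}=\{(r,e,d)\in\mathscr{B}(p): 2\le r\le p-1,\ r\nmid p-1\}$.
   Context: For a polynomial $F(x)\in\mathbb{F}_p[x]$ and integers $e\ge0$, $0\le d\le p$, write $F(x)^e=\sum_{i\ge0}c_ix^i$ and let $M_d(F(x)^e)$ be the $d\times d$ matrix over $\mathbb{F}_p$ with $(i,j)$ entry $c_{ip+j-d-1}$ ($1\le i,j\le d$). For integers $(r,e,d)$ put $g=\left\{red-\frac{d(d+1)}{2}(p-1)\right\}\Big/\frac{r(r-1)}{2}$. $\mathscr{U}(p)$ is the set of $(r,e,d)\in\mathbb{Z}^3$ with $r\ge2$, $e\ge1$, $1\le d\le p$, $d(p-1)\le re\le r(p-1)$, $g>0$, and $g\in2\mathbb{Z}$ when $p\ne2$, $g\in\mathbb{Z}$ when $p=2$. $\mathscr{B}_+(p)=\{(r,e,d)\in\mathbb{Z}^3: 2\le r\le p,\ e=p-1,\ d=r\}$, $\mathscr{B}_0(p)=\{(r,e,d)\in\mathbb{Z}^3: 2\le r\le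 p+1,\ (p-1)/2<e\le p-1,\ r(p-1-e)\le p-1,\ d=r-1\}$, $\mathscr{B}_-(p)=\{(r,e,d)\in\mathbb{Z}^3: r\ge2,\ (p-1)/2<e\le p-1,\ r(p-1-e)=p-1,\ d=r-2\}$, and $\mathscr{B}(p)=\mathscr{B}_+(p)\cup\mathscr{B}_0(p)\cup\mathscr{B}_-(p)$. -}

module Defs where

open import Data.Nat as ℕ using (ℕ; zero; suc)
open import Data.Nat.Primality using (Prime)
open import Data.Integer as ℤ using (ℤ; +_; -[1+_]; ∣_∣)
open import Data.Integer.Divisibility as ℤD using ()
open import Data.Fin using (Fin; zero; suc; toℕ; punchIn)
open import Data.List using (List; []; _∷_; map; replicate; _++_)
open import Data.Product using (_×_; Σ; ∃; _,_)
open import Data.Sum using (_⊎_)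
open import Relation.Nullary using (¬_)
open import Relation.Binary.PropositionalEquality using (_≡_; _≢_)
open import Function.Bundles using (_⇔_)

-- Polynomials with integer coefficients as coefficient lists
-- (constant term first).  Polynomials over 𝔽_p are represented by
-- integer lifts; reduction mod p is a ring homomorphism ℤ[x] → 𝔽_p[x]
-- and ℤ → 𝔽_p, so coefficients and determinants over 𝔽_p are the
-- reductions mod p of the integer ones computed here.

Poly : Set
Poly = List ℤ

_⊕_ : Poly → Poly → Poly
[]      ⊕ q       = q
(a ∷ f) ⊕ []      = a ∷ f
(a ∷ f) ⊕ (b ∷ g) = (a ℤ.+ b) ∷ (f ⊕ g)

_⊗_ : Poly → Poly → Poly
[]      ⊗ g = []
(a ∷ f) ⊗ g = map (a ℤ.*_) g ⊕ (ℤ.0ℤ ∷ (f ⊗ g))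

monomial : ℕ → ℤ → Poly
monomial k c = replicate k ℤ.0ℤ ++ (c ∷ [])

_^ᴾ_ : Poly → ℕ → Poly
f ^ᴾ zero  = ℤ.1ℤ ∷ []
f ^ᴾ suc e = f ⊗ (f ^ᴾ e)

coeff : Poly → ℕ → ℤ
coeff []      _       = ℤ.0ℤ
coeff (a ∷ f) zero    = a
coeff (a ∷ f) (suc i) = coeff f i

trinomial : ℕ → Poly
trinomial r = monomial r ℤ.1ℤ ⊕ (monomial 1 ℤ.-1ℤ ⊕ monomial 0 ℤ.-1ℤ)

binomial : ℕ → Poly
binomial r = monomial r ℤ.1ℤ ⊕ monomial 0 ℤ.-1ℤ

sumFin : ∀ n → (Fin n → ℤ) → ℤ
sumFin zero    f = ℤ.0ℤ
sumFin (suc n) f = f zero ℤ.+ sumFin n (λ i → f (suc i))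

det : ∀ n → (Fin n → Fin n → ℤ) → ℤ
det zero    M = ℤ.1ℤ
det (suc n) M =
  sumFin (suc n) (λ j → (ℤ.-1ℤ ℤ.^ toℕ j) ℤ.* M zero j ℤ.* det n (λ i k → M (suc i) (punchIn j k)))

-- M_d(F^e) for the prime p: the (i,j) entry (1-based) is c_{ip+j-d-1}.
-- With 0-based Fin indices i,j this is c_{(i+1)p+(j+1)-d-1}; the index is
-- always ≥ p - d ≥ 0 since d ≤ p, so truncated subtraction is harmless.
Mat : (p : ℕ) (F : Poly) (e d : ℕ) → Fin d → Fin d → ℤ
Mat p F e d i j = coeff (F ^ᴾ e) ((suc (toℕ i) ℕ.* p ℕ.+ suc (toℕ j)) ℕ.∸ (d ℕ.+ 1))

detNonzero : (p : ℕ) (F : Poly) (e d : ℕ) → Set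
detNonzero p F e d = ¬ ((+ p) ℤD.∣ det d (Mat p F e d))

Triple : Set
Triple = ℤ × ℤ × ℤ

-- g is the rational number {red - d(d+1)(p-1)/2} / {r(r-1)/2}; "g > 0 and
-- g ∈ 2ℤ (resp. ℤ)" means there is an integer g with
-- g · r(r-1) = 2red - d(d+1)(p-1), g > 0, and 2 ∣ g when p ≠ 2.
gCond : ℕ → Triple → Set
gCond p (r , e , d) =
  Σ ℤ λ g →
    (g ℤ.* (r ℤ.* (r ℤ.- ℤ.1ℤ)) ≡ (+ 2) ℤ.* r ℤ.* e ℤ.* d ℤ.- d ℤ.* (d ℤ.+ ℤ.1ℤ) ℤ.* (+ p ℤ.- ℤ.1ℤ))
    × ℤ.0ℤ ℤ.< g
    × (p ≢ 2 → (+ 2) ℤD.∣ g)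

InU : ℕ → Triple → Set
InU p (r , e , d) =
  (+ 2) ℤ.≤ r × ℤ.1ℤ ℤ.≤ e × ℤ.1ℤ ℤ.≤ d × d ℤ.≤ + p
  × d ℤ.* (+ p ℤ.- ℤ.1ℤ) ℤ.≤ r ℤ.* e
  × r ℤ.* e ℤ.≤ r ℤ.* (+ p ℤ.- ℤ.1ℤ)
  × gCond p (r , e , d)

InB₊ : ℕ → Triple → Set
InB₊ p (r , e , d) = (+ 2) ℤ.≤ r × r ℤ.≤ + p × e ≡ + p ℤ.- ℤ.1ℤ × d ≡ r

-- (p-1)/2 < e  is written  p - 1 < 2e
InB₀ : ℕ → Triple → Set
InB₀ p (r , e , d) =
  (+ 2) ℤ.≤ r × r ℤ.≤ + p ℤ.+ ℤ.1ℤ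
  × (+ p ℤ.- ℤ.1ℤ) ℤ.< (+ 2) ℤ.* e × e ℤ.≤ + p ℤ.- ℤ.1ℤ
  × r ℤ.* (+ p ℤ.- ℤ.1ℤ ℤ.- e) ℤ.≤ + p ℤ.- ℤ.1ℤ
  × d ≡ r ℤ.- ℤ.1ℤ

InB₋ : ℕ → Triple → Set
InB₋ p (r , e , d) =
  (+ 2) ℤ.≤ r
  × (+ p ℤ.- ℤ.1ℤ) ℤ.< (+ 2) ℤ.* e × e ℤ.≤ + p ℤ.- ℤ.1ℤ
  × r ℤ.* (+ p ℤ.- ℤ.1ℤ ℤ.- e) ≡ + p ℤ.- ℤ.1ℤ
  × d ≡ r ℤ.- (+ 2)

InB : ℕ → Triple → Set
InB p t = InB₊ p t ⊎ InB₀ p t ⊎ InB₋ p t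

-- det M_d(F^e) ≠ 0 for an integer triple (r,e,d); only used on triples
-- in 𝒰(p), where r, e, d are positive so ∣_∣ is the identity.
detNZ : ℕ → (ℕ → Poly) → Triple → Set
detNZ p F (r , e , d) = detNonzero p (F ∣ r ∣) ∣ e ∣ ∣ d ∣

Lemma6 : Set
Lemma6 =
  ∀ (p : ℕ) → Prime p →
    (∀ (r e d : ℤ) →
        (InU p (r , e , d) × (+ p) ℤD.∣ r × detNZ p trinomial (r , e , d))
      ⇔ (InB p (r , e , d) × (+ p) ℤD.∣ r))
  × (∀ (r e d : ℤ) →
        (InU p (r , e , d) × + p ℤ.< r × ¬ ((+ p) ℤD.∣ r) × detNZ p binomial (r , e , d))
      ⇔ (InB p (r , e , d) × + p ℤ.< r × ¬ ((+ p) ℤD.∣ r)))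
  × (∀ (r e d : ℤ) →
        (InU p (r , e , d) × (+ 2) ℤ.≤ r × r ℤ.≤ + p ℤ.- ℤ.1ℤ × ¬ (r ℤD.∣ (+ p ℤ.- ℤ.1ℤ)) × detNZ p binomial (r , e , d))
      ⇔ (InB p (r , e , d) × (+ 2) ℤ.≤ r × r ℤ.≤ + p ℤ.- ℤ.1ℤ × ¬ (r ℤD.∣ (+ p ℤ.- ℤ.1ℤ))))

{-# OPTIONS --safe #-}
-- Row i of M_d(F^e) lists the coefficients of F^e at the d consecutive exponents
-- i p + (p - d), …, i p + p - 1.  For F = x^r - 1 the only nonzero coefficients are
-- ±C(e, a) at the multiples a r, and p ∤ C(e, a) since e < p.  So det M_d ≢ 0 (mod p)
-- forces every row window to contain a multiple of r, while if each window contains exactly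
-- one, M_d is a monomial matrix with unit entries.  For p < r this gives d = p and, comparing
-- the multiples found in successive rows, r = p + 1.  For r < p it says that x ↦ x p mod r
-- maps 1, …, d into 1, …, d, which is impossible for d ≤ r - 2 because x p + p ≡ x p + q
-- with q = p mod r ≥ 2 (as r ∤ p and r ∤ p - 1).  Hence d ∈ {r - 1, r}, and then the
-- conditions of 𝒰(p) become those of 𝓑(p).  For F = x^p - x - 1 and e = p - 1, M_d is
-- anti-triangular with entries ±C(p - 1, i) on the anti-diagonal; conversely, for r = p the
-- last row forces e = p - 1 and the equation defining g forces p ∣ d (d + 1), while r ≥ 2p
-- is excluded by the second row (or, when d = 1, by the equation defining g).
module Submission where

open import Defs

open import Data.Nat as ℕ
  using (ℕ; zero; suc; _+_; _*_; _∸_; _≤_; _<_; _>_; z≤n; s≤s; s≤s⁻¹; z<s; NonZero; >-nonZero; ≢-nonZero; _%_; _/_; _!; pred)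
open import Data.Nat.Properties
open import Data.Nat.Divisibility using (_∣_; m%n≡0⇒n∣m; divides; ∣⇒≤; ∣1⇒≡1; ∣-trans; ∣m+n∣m⇒∣n; n∣m*n)
open import Data.Nat.DivMod using (m≡m%n+[m/n]*n; m%n<n; %-distribˡ-+; [m+kn]%n≡m%n; m<n⇒m%n≡m; m*[n/m]≡n)
open import Data.Nat.Combinatorics using (_C_; nCk≡n!/k![n-k]!; k>n⇒nCk≡0; nCk+nC[k+1]≡[n+1]C[k+1]; k![n∸k]!∣n!)
open import Data.Nat.Coprimality as Coprime using (Coprime; coprime-divisor)
open import Data.Nat.Primality using (Prime; euclidsLemma; prime⇒nonTrivial; prime⇒nonZero; prime⇒irreducible)
import Data.Nat.Tactic.RingSolver as ℕ-Ring
open import Data.Integer as ℤ using (ℤ; +_; ∣_∣)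
import Data.Integer.Properties as ℤP
import Data.Integer.Divisibility as ℤD
import Data.Integer.Tactic.RingSolver as ℤ-Ring
open import Data.Fin using (Fin; zero; suc; toℕ; punchIn; punchOut; fromℕ; fromℕ<)
import Data.Fin.Properties as Fin
open import Data.List using ([]; _∷_; map)
open import Data.Product using (∃; ∃₂; _×_; _,_; proj₁; proj₂)
open import Data.Sum using (_⊎_; inj₁; inj₂; [_,_]′)
open import Function using (_∘_)
open import Function.Bundles using (_⇔_; mk⇔; Equivalence)
open import Function.Definitions using (Injective)
open import Relation.Binary using (tri<; tri≈; tri>)
open import Relation.Binary.PropositionalEquality
open import Relation.Nullary using (¬_; yes; no; contradiction)
open import Relation.Nullary.Decidable using (decidable-stable)

prime>1 : ∀ {p} → Prime p → 1 < p
prime>1 {p} pp = ℕ.nonTrivial⇒n>1 p {{prime⇒nonTrivial pp}}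

prime∤1 : ∀ {p} → Prime p → ¬ p ∣ 1
prime∤1 pp p∣1 = <⇒≢ (prime>1 pp) (sym (∣1⇒≡1 p∣1))

prime∤* : ∀ {p m n} → Prime p → ¬ p ∣ m → ¬ p ∣ n → ¬ p ∣ m * n
prime∤* {m = m} {n} pp p∤m p∤n p∣mn = [ p∤m , p∤n ]′ (euclidsLemma m n pp p∣mn)

prime∤! : ∀ {p} → Prime p → ∀ n → n < p → ¬ p ∣ n !
prime∤! pp zero    _   = prime∤1 pp
prime∤! pp (suc n) n<p =
  prime∤* pp (λ p∣n → <⇒≱ n<p (∣⇒≤ p∣n)) (prime∤! pp n (<-trans (n<1+n n) n<p))

prime∤C : ∀ {p} → Prime p → ∀ {n k} → n < p → k ≤ n → ¬ p ∣ n C k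
prime∤C pp {n} {k} n<p k≤n p∣nCk = prime∤! pp n n<p (∣-trans p∣nCk (divides (k ! * (n ∸ k) !) n!≡))
  where
  instance _ : NonZero (k ! * (n ∸ k) !)
           _ = k !* (n ∸ k) !≢0
  n!≡ : n ! ≡ k ! * (n ∸ k) ! * (n C k)
  n!≡ = begin
    n !                                           ≡⟨ m*[n/m]≡n (k![n∸k]!∣n! k≤n) ⟨
    k ! * (n ∸ k) ! * (n ! / (k ! * (n ∸ k) !))   ≡⟨ cong (k ! * (n ∸ k) ! *_) (nCk≡n!/k![n-k]! k≤n) ⟨
    k ! * (n ∸ k) ! * (n C k)                     ∎
    where open ≡-Reasoning

quotRem-unique : ∀ {r m m′} a a′ → m < r → m′ < r → a * r + m ≡ a′ * r + m′ → a ≡ a′ × m ≡ m′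
quotRem-unique {r} {m} {m′} a a′ m<r m′<r eq = a≡a′ , m≡m′
  where
  instance _ : NonZero r
           _ = >-nonZero (≤-<-trans z≤n m<r)
  remainder : ∀ b {n} → n < r → (b * r + n) % r ≡ n
  remainder b {n} n<r = trans (cong (_% r) (+-comm (b * r) n)) (trans ([m+kn]%n≡m%n n b r) (m<n⇒m%n≡m n<r))
  m≡m′ : m ≡ m′
  m≡m′ = trans (sym (remainder a m<r)) (trans (cong (_% r) eq) (remainder a′ m′<r))
  a≡a′ : a ≡ a′
  a≡a′ = *-cancelʳ-≡ a a′ r (+-cancelʳ-≡ _ _ _ (trans eq (cong (λ n → a′ * r + n) (sym m≡m′))))

multiplesInWindow-unique≤ : ∀ {R L j k} a b → j ≤ k → k < R → L + j ≡ a * R → L + k ≡ b * R → j ≡ k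
multiplesInWindow-unique≤ {R} {L} {j} {k} a b j≤k k<R L+j≡aR L+k≡bR =
  ≤-antisym j≤k (m∸n≡0⇒m≤n (sym (proj₂ (quotRem-unique b a (≤-<-trans z≤n k<R) (≤-<-trans (m∸n≤m k j) k<R) bR≡aR+k∸j))))
  where
  open ≡-Reasoning
  bR≡aR+k∸j : b * R + 0 ≡ a * R + (k ∸ j)
  bR≡aR+k∸j = begin
    b * R + 0          ≡⟨ +-identityʳ (b * R) ⟩
    b * R              ≡⟨ L+k≡bR ⟨
    L + k              ≡⟨ cong (_+_ L) (m+[n∸m]≡n j≤k) ⟨
    L + (j + (k ∸ j))  ≡⟨ +-assoc L j (k ∸ j) ⟨
    L + j + (k ∸ j)    ≡⟨ cong (_+ (k ∸ j)) L+j≡aR ⟩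
    a * R + (k ∸ j)    ∎

multiplesInWindow-unique : ∀ {R L j k} a b → j < R → k < R → L + j ≡ a * R → L + k ≡ b * R → j ≡ k
multiplesInWindow-unique {j = j} {k} a b j<R k<R L+j≡aR L+k≡bR with ≤-total j k
... | inj₁ j≤k = multiplesInWindow-unique≤ a b j≤k k<R L+j≡aR L+k≡bR
... | inj₂ k≤j = sym (multiplesInWindow-unique≤ b a k≤j j<R L+k≡bR L+j≡aR)

m∣n∧0<n<2m⇒n≡m : ∀ {m n} → m ∣ n → 0 < n → n < 2 * m → n ≡ m
m∣n∧0<n<2m⇒n≡m {m} (divides 0             refl) ()
m∣n∧0<n<2m⇒n≡m {m} (divides 1             refl) _ _ = *-identityˡ m
m∣n∧0<n<2m⇒n≡m {m} (divides (suc (suc k)) refl) _ n<2m =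
  contradiction (+-monoʳ-≤ m (+-monoʳ-≤ m z≤n)) (<⇒≱ n<2m)

injective⇒surjective : ∀ {n} (f : Fin n → Fin n) → Injective _≡_ _≡_ f → ∀ y → ∃ λ x → f x ≡ y
injective⇒surjective {suc m} f f-inj y = decidable-stable (Fin.any? (λ x → f x Fin.≟ y)) λ noHit →
  let missed : ∀ x → y ≢ f x
      missed x y≡fx = noHit (x , sym y≡fx)
      (i , j , i<j , eq) = Fin.pigeonhole (n<1+n m) (λ x → punchOut (missed x))
  in <-irrefl (cong toℕ (f-inj (Fin.punchOut-injective (missed i) (missed j) eq))) i<j

injectiveOn⇒surjectiveOn : ∀ n (h : ℕ → ℕ) → (∀ {i} → i < n → h i < n) →
                           (∀ {i i′} → i < n → i′ < n → h i ≡ h i′ → i ≡ i′) →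
                           ∀ {t} → t < n → ∃ λ i → i < n × h i ≡ t
injectiveOn⇒surjectiveOn n h h<n h-inj {t} t<n with injective⇒surjective H H-inj (fromℕ< t<n)
  where
  H : Fin n → Fin n
  H i = fromℕ< (h<n (Fin.toℕ<n i))
  H-inj : Injective _≡_ _≡_ H
  H-inj {i} {i′} Hi≡Hi′ = Fin.toℕ-injective (h-inj (Fin.toℕ<n i) (Fin.toℕ<n i′)
    (trans (sym (Fin.toℕ-fromℕ< _)) (trans (cong toℕ Hi≡Hi′) (Fin.toℕ-fromℕ< _))))
... | i , Hi≡t = toℕ i , Fin.toℕ<n i , trans (sym (Fin.toℕ-fromℕ< _)) (trans (cong toℕ Hi≡t) (Fin.toℕ-fromℕ< t<n))

-- Both D - q and D - q + 1 are values of h, and a value t with D ≤ t + q < R can only be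
-- taken at i = D - 1, since h (i + 1) = t + q would leave [0, D).
rotation-notInjectiveOn : ∀ {R D q} (h : ℕ → ℕ) .{{_ : NonZero R}} → 2 ≤ q → q ≤ D → 2 + D ≤ R →
                          (∀ {i} → i < D → h i < D) → (∀ {i i′} → i < D → i′ < D → h i ≡ h i′ → i ≡ i′) →
                          ¬ (∀ i → h (suc i) ≡ (h i + q) % R)
rotation-notInjectiveOn {R} {D} {q} h 2≤q q≤D 2+D≤R h<D h-inj h-step with pick 0 z≤n | pick 1 ≤-refl
  where
  onlyLast : ∀ {t i} → D ≤ t + q → t + q < R → i < D → h i ≡ t → suc i ≡ D
  onlyLast {t} {i} D≤t+q t+q<R i<D hi≡t with suc i <? D
  ... | no  1+i≮D = ≤-antisym i<D (≮⇒≥ 1+i≮D)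
  ... | yes 1+i<D = contradiction (h<D 1+i<D) (≤⇒≯ (≤-trans D≤t+q (≤-reflexive (sym h[1+i]≡t+q))))
    where
    h[1+i]≡t+q : h (suc i) ≡ t + q
    h[1+i]≡t+q = trans (h-step i) (trans (cong (λ x → (x + q) % R) hi≡t) (m<n⇒m%n≡m t+q<R))
  pick : ∀ k → k ≤ 1 → ∃ λ i → h i ≡ k + (D ∸ q) × suc i ≡ D
  pick k k≤1 with injectiveOn⇒surjectiveOn D h h<D h-inj t<D
    where
    t<D : k + (D ∸ q) < D
    t<D = begin-strict
      k + (D ∸ q)     ≤⟨ +-monoˡ-≤ (D ∸ q) k≤1 ⟩
      1 + (D ∸ q)     <⟨ ≤-trans (≤-reflexive (+-comm 2 (D ∸ q))) (+-monoʳ-≤ (D ∸ q) 2≤q) ⟩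
      D ∸ q + q       ≡⟨ m∸n+n≡m q≤D ⟩
      D               ∎
      where open ≤-Reasoning
  ... | i , i<D , hi≡t = i , hi≡t , onlyLast (≤-trans (m≤n+m D k) (≤-reflexive (sym t+q≡k+D))) t+q<R i<D hi≡t
    where
    t+q≡k+D : k + (D ∸ q) + q ≡ k + D
    t+q≡k+D = trans (+-assoc k (D ∸ q) q) (cong (_+_ k) (m∸n+n≡m q≤D))
    t+q<R : k + (D ∸ q) + q < R
    t+q<R = ≤-<-trans (≤-reflexive t+q≡k+D) (<-≤-trans (+-monoˡ-< D (s≤s k≤1)) 2+D≤R)
... | i₀ , hi₀≡ , 1+i₀≡D | i₁ , hi₁≡ , 1+i₁≡D =
  1+n≢n (sym (trans (sym hi₀≡) (trans (cong h (suc-injective (trans 1+i₀≡D (sym 1+i₁≡D)))) hi₁≡)))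

[m∸1]%n≡m%n∸1 : ∀ m n .{{_ : NonZero n}} → m % n ≢ 0 → (m ∸ 1) % n ≡ m % n ∸ 1
[m∸1]%n≡m%n∸1 m n m%n≢0 = begin
  (m ∸ 1) % n                   ≡⟨ cong (λ k → (k ∸ 1) % n) (m≡m%n+[m/n]*n m n) ⟩
  (m % n + m / n * n ∸ 1) % n   ≡⟨ cong (_% n) (+-∸-comm (m / n * n) (n≢0⇒n>0 m%n≢0)) ⟩
  (m % n ∸ 1 + m / n * n) % n   ≡⟨ [m+kn]%n≡m%n (m % n ∸ 1) (m / n) n ⟩
  (m % n ∸ 1) % n               ≡⟨ m<n⇒m%n≡m (≤-<-trans (m∸n≤m (m % n) 1) (m%n<n m n)) ⟩
  m % n ∸ 1                     ∎
  where open ≡-Reasoning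

∣m∣n⇒∣m∸n : ∀ {d m n} → d ∣ m → d ∣ n → d ∣ m ∸ n
∣m∣n⇒∣m∸n {d} (divides a refl) (divides b refl) = divides (a ∸ b) (sym (*-distribʳ-∸ d a b))

pred[R]P≤RE⇔R[P∸E]≤P : ∀ R′ {P E} → E ≤ P → (R′ * P ≤ suc R′ * E) ⇔ (suc R′ * (P ∸ E) ≤ P)
pred[R]P≤RE⇔R[P∸E]≤P R′ {P} {E} E≤P = mk⇔
  (λ R′P≤RE → +-cancelˡ-≤ (R * E) _ _ (begin
    R * E + R * (P ∸ E)   ≡⟨ RP≡ ⟨
    P + R′ * P            ≤⟨ +-monoʳ-≤ P R′P≤RE ⟩
    P + R * E             ≡⟨ +-comm P (R * E) ⟩
    R * E + P             ∎))
  (λ R[P∸E]≤P → +-cancelˡ-≤ P _ _ (begin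
    P + R′ * P            ≡⟨ RP≡ ⟩
    R * E + R * (P ∸ E)   ≤⟨ +-monoʳ-≤ (R * E) R[P∸E]≤P ⟩
    R * E + P             ≡⟨ +-comm (R * E) P ⟩
    P + R * E             ∎))
  where
  open ≤-Reasoning
  R : ℕ
  R = suc R′
  RP≡ : R * P ≡ R * E + R * (P ∸ E)
  RP≡ = trans (cong (R *_) (sym (m+[n∸m]≡n E≤P))) (*-distribˡ-+ R E (P ∸ E))

-- the case x = E is excluded since it forces R = 2 and E + x = 2E
Rx≤E+x⇒x<E : ∀ {R E x} → 2 ≤ R → 1 ≤ E → R * x ≤ E + x → ¬ R ∣ E + x → x < E
Rx≤E+x⇒x<E {R@(suc R′)} {E} {x} 2≤R 1≤E Rx≤E+x R∤E+x with m≤n⇒m<n∨m≡n x≤E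
  where
  x≤E : x ≤ E
  x≤E = +-cancelʳ-≤ x x E (≤-trans (+-monoʳ-≤ x (m≤n*m x R′ {{>-nonZero (s≤s⁻¹ 2≤R)}})) Rx≤E+x)
... | inj₁ x<E = x<E
... | inj₂ refl = contradiction (subst (_∣ E + E) (sym R≡2) (divides E E+E≡E*2)) R∤E+x
  where
  E+E≡E*2 : E + E ≡ E * 2
  E+E≡E*2 = trans (cong (_+_ E) (sym (+-identityʳ E))) (*-comm 2 E)
  R≡2 : R ≡ 2
  R≡2 = ≤-antisym (*-cancelʳ-≤ R 2 E {{>-nonZero 1≤E}} (≤-trans Rx≤E+x (≤-reflexive (trans E+E≡E*2 (*-comm E 2))))) 2≤R

-- Determinants modulo a prime

∣-1^n∣≡1 : ∀ n → ∣ ℤ.-1ℤ ℤ.^ n ∣ ≡ 1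
∣-1^n∣≡1 zero    = refl
∣-1^n∣≡1 (suc n) = trans (ℤP.abs-* ℤ.-1ℤ (ℤ.-1ℤ ℤ.^ n)) (trans (*-identityˡ _) (∣-1^n∣≡1 n))

∣-1^n*i∣≡∣i∣ : ∀ n i → ∣ ℤ.-1ℤ ℤ.^ n ℤ.* i ∣ ≡ ∣ i ∣
∣-1^n*i∣≡∣i∣ n i = trans (ℤP.abs-* (ℤ.-1ℤ ℤ.^ n) i) (trans (cong (_* ∣ i ∣) (∣-1^n∣≡1 n)) (*-identityˡ ∣ i ∣))

sumFin-zeros : ∀ n (f : Fin n → ℤ) → (∀ j → f j ≡ ℤ.0ℤ) → sumFin n f ≡ ℤ.0ℤ
sumFin-zeros zero    f f≡0 = refl
sumFin-zeros (suc n) f f≡0 = cong₂ ℤ._+_ (f≡0 zero) (sumFin-zeros n (f ∘ suc) (f≡0 ∘ suc))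

sumFin-single : ∀ n (f : Fin n → ℤ) j₀ → (∀ j → j ≢ j₀ → f j ≡ ℤ.0ℤ) → sumFin n f ≡ f j₀
sumFin-single (suc n) f zero f≡0 =
  trans (cong (λ x → f zero ℤ.+ x) (sumFin-zeros n (f ∘ suc) (λ j → f≡0 (suc j) λ ())))
        (ℤP.+-identityʳ (f zero))
sumFin-single (suc n) f (suc j₀) f≡0 =
  trans (cong (ℤ._+ sumFin n (f ∘ suc)) (f≡0 zero λ ()))
        (trans (ℤP.+-identityˡ _) (sumFin-single n (f ∘ suc) j₀ (λ j j≢j₀ → f≡0 (suc j) (j≢j₀ ∘ Fin.suc-injective))))

Matrix : ℕ → Set
Matrix n = Fin n → Fin n → ℤ

minor : ∀ {n} → Matrix (suc n) → Fin (suc n) → Matrix n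
minor M j i k = M (suc i) (punchIn j k)

expansionTerm : ∀ {n} → Matrix (suc n) → Fin (suc n) → ℤ
expansionTerm {n} M j = ℤ.-1ℤ ℤ.^ toℕ j ℤ.* M zero j ℤ.* det n (minor M j)

expansionTerm-entry≡0 : ∀ {n} (M : Matrix (suc n)) j → M zero j ≡ ℤ.0ℤ → expansionTerm M j ≡ ℤ.0ℤ
expansionTerm-entry≡0 {n} M j M₀ⱼ≡0 = begin
  ℤ.-1ℤ ℤ.^ toℕ j ℤ.* M zero j ℤ.* det n (minor M j) ≡⟨ cong (λ x → ℤ.-1ℤ ℤ.^ toℕ j ℤ.* x ℤ.* det n (minor M j)) M₀ⱼ≡0 ⟩
  ℤ.-1ℤ ℤ.^ toℕ j ℤ.* ℤ.0ℤ ℤ.* det n (minor M j)   ≡⟨ cong (ℤ._* det n (minor M j)) (ℤP.*-zeroʳ (ℤ.-1ℤ ℤ.^ toℕ j)) ⟩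
  ℤ.0ℤ ℤ.* det n (minor M j)                         ≡⟨ ℤP.*-zeroˡ (det n (minor M j)) ⟩
  ℤ.0ℤ                                               ∎
  where open ≡-Reasoning

expansionTerm-minor≡0 : ∀ {n} (M : Matrix (suc n)) j → det n (minor M j) ≡ ℤ.0ℤ → expansionTerm M j ≡ ℤ.0ℤ
expansionTerm-minor≡0 {n} M j detMinor≡0 =
  trans (cong (ℤ.-1ℤ ℤ.^ toℕ j ℤ.* M zero j ℤ.*_) detMinor≡0) (ℤP.*-zeroʳ (ℤ.-1ℤ ℤ.^ toℕ j ℤ.* M zero j))

∣expansionTerm∣ : ∀ {n} (M : Matrix (suc n)) j → ∣ expansionTerm M j ∣ ≡ ∣ M zero j ∣ * ∣ det n (minor M j) ∣
∣expansionTerm∣ {n} M j = begin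
  ∣ ℤ.-1ℤ ℤ.^ toℕ j ℤ.* M zero j ℤ.* det n (minor M j) ∣   ≡⟨ cong ∣_∣ (ℤP.*-assoc (ℤ.-1ℤ ℤ.^ toℕ j) _ _) ⟩
  ∣ ℤ.-1ℤ ℤ.^ toℕ j ℤ.* (M zero j ℤ.* det n (minor M j)) ∣ ≡⟨ ∣-1^n*i∣≡∣i∣ (toℕ j) _ ⟩
  ∣ M zero j ℤ.* det n (minor M j) ∣                       ≡⟨ ℤP.abs-* (M zero j) _ ⟩
  ∣ M zero j ∣ * ∣ det n (minor M j) ∣                     ∎
  where open ≡-Reasoning

det-zeroRow : ∀ n (M : Matrix n) i → (∀ j → M i j ≡ ℤ.0ℤ) → det n M ≡ ℤ.0ℤ
det-zeroRow (suc n) M zero    Mᵢ≡0 = sumFin-zeros (suc n) (expansionTerm M) λ j →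
  expansionTerm-entry≡0 M j (Mᵢ≡0 j)
det-zeroRow (suc n) M (suc i) Mᵢ≡0 = sumFin-zeros (suc n) (expansionTerm M) λ j →
  expansionTerm-minor≡0 M j (det-zeroRow n (minor M j) i (Mᵢ≡0 ∘ punchIn j))

det-zeroCol : ∀ n (M : Matrix n) k → (∀ i → M i k ≡ ℤ.0ℤ) → det n M ≡ ℤ.0ℤ
det-zeroCol (suc n) M k M·ₖ≡0 = sumFin-zeros (suc n) (expansionTerm M) term≡0
  where
  term≡0 : ∀ j → expansionTerm M j ≡ ℤ.0ℤ
  term≡0 j with j Fin.≟ k
  ... | yes refl = expansionTerm-entry≡0 M j (M·ₖ≡0 zero)
  ... | no  j≢k  = expansionTerm-minor≡0 M j (det-zeroCol n (minor M j) (punchOut j≢k) λ i →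
    trans (cong (M (suc i)) (Fin.punchIn-punchOut j≢k)) (M·ₖ≡0 (suc i)))

∣det∣-singleTerm : ∀ {n} (M : Matrix (suc n)) j₀ → (∀ j → j ≢ j₀ → expansionTerm M j ≡ ℤ.0ℤ) →
                   ∣ det (suc n) M ∣ ≡ ∣ M zero j₀ ∣ * ∣ det n (minor M j₀) ∣
∣det∣-singleTerm {n} M j₀ others≡0 =
  trans (cong ∣_∣ (sumFin-single (suc n) (expansionTerm M) j₀ others≡0)) (∣expansionTerm∣ M j₀)

toℕ-punchIn-fromℕ : ∀ n (k : Fin n) → toℕ (punchIn (fromℕ n) k) ≡ toℕ k
toℕ-punchIn-fromℕ (suc n) zero    = refl
toℕ-punchIn-fromℕ (suc n) (suc k) = cong suc (toℕ-punchIn-fromℕ n k)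

module _ {p : ℕ} (pp : Prime p) where

  prime∤det-expansion : ∀ {n} (M : Matrix (suc n)) j₀ → (∀ j → j ≢ j₀ → expansionTerm M j ≡ ℤ.0ℤ) →
                        ¬ p ∣ ∣ M zero j₀ ∣ → ¬ p ∣ ∣ det n (minor M j₀) ∣ → ¬ p ∣ ∣ det (suc n) M ∣
  prime∤det-expansion M j₀ others≡0 p∤entry p∤minor p∣det =
    prime∤* pp p∤entry p∤minor (subst (p ∣_) (∣det∣-singleTerm M j₀ others≡0) p∣det)

  prime∤det-monomial : ∀ n (M : Matrix n) (σ : Fin n → Fin n) → Injective _≡_ _≡_ σ →
                       (∀ i j → j ≢ σ i → M i j ≡ ℤ.0ℤ) → (∀ i → ¬ p ∣ ∣ M i (σ i) ∣) →
                       ¬ p ∣ ∣ det n M ∣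
  prime∤det-monomial zero    M σ σ-inj off≡0 p∤diag = prime∤1 pp
  prime∤det-monomial (suc n) M σ σ-inj off≡0 p∤diag =
    prime∤det-expansion M (σ zero) (λ j j≢σ₀ → expansionTerm-entry≡0 M j (off≡0 zero j j≢σ₀)) (p∤diag zero)
      (prime∤det-monomial n (minor M (σ zero)) σ′ σ′-inj off′≡0 p∤diag′)
    where
    σ₀≢σₛ : ∀ i → σ zero ≢ σ (suc i)
    σ₀≢σₛ i eq with σ-inj eq
    ... | ()
    σ′ : Fin n → Fin n
    σ′ i = punchOut (σ₀≢σₛ i)
    punchIn-σ′ : ∀ i → punchIn (σ zero) (σ′ i) ≡ σ (suc i)
    punchIn-σ′ i = Fin.punchIn-punchOut (σ₀≢σₛ i)
    σ′-inj : Injective _≡_ _≡_ σ′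
    σ′-inj eq = Fin.suc-injective (σ-inj (Fin.punchOut-injective (σ₀≢σₛ _) (σ₀≢σₛ _) eq))
    off′≡0 : ∀ i k → k ≢ σ′ i → minor M (σ zero) i k ≡ ℤ.0ℤ
    off′≡0 i k k≢σ′ᵢ = off≡0 (suc i) (punchIn (σ zero) k) λ eq →
      k≢σ′ᵢ (Fin.punchIn-injective (σ zero) k (σ′ i) (trans eq (sym (punchIn-σ′ i))))
    p∤diag′ : ∀ i → ¬ p ∣ ∣ minor M (σ zero) i (σ′ i) ∣
    p∤diag′ i = subst (λ j → ¬ p ∣ ∣ M (suc i) j ∣) (sym (punchIn-σ′ i)) (p∤diag (suc i))

  prime∤det-antiTriangular : ∀ n (M : Matrix n) →
                             (∀ i j → n ≤ toℕ i + toℕ j → M i j ≡ ℤ.0ℤ) →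
                             (∀ i j → suc (toℕ i + toℕ j) ≡ n → ¬ p ∣ ∣ M i j ∣) →
                             ¬ p ∣ ∣ det n M ∣
  prime∤det-antiTriangular zero    M below≡0 p∤anti = prime∤1 pp
  prime∤det-antiTriangular (suc n) M below≡0 p∤anti =
    prime∤det-expansion M last others≡0 (p∤anti zero last (cong suc (Fin.toℕ-fromℕ n)))
      (prime∤det-antiTriangular n (minor M last) below′≡0 p∤anti′)
    where
    last : Fin (suc n)
    last = fromℕ n
    toℕ-punchIn-last : ∀ k → toℕ (punchIn last k) ≡ toℕ k
    toℕ-punchIn-last = toℕ-punchIn-fromℕ n
    others≡0 : ∀ j → j ≢ last → expansionTerm M j ≡ ℤ.0ℤ
    others≡0 j j≢last = expansionTerm-minor≡0 M j (det-zeroCol n (minor M j) (punchOut j≢last) λ i →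
      below≡0 (suc i) _ (subst (λ k → suc n ≤ suc (toℕ i + toℕ k)) (sym (Fin.punchIn-punchOut j≢last))
        (subst (λ m → suc n ≤ suc (toℕ i + m)) (sym (Fin.toℕ-fromℕ n)) (s≤s (m≤n+m n (toℕ i))))))
    below′≡0 : ∀ i k → n ≤ toℕ i + toℕ k → minor M last i k ≡ ℤ.0ℤ
    below′≡0 i k n≤i+k = below≡0 (suc i) (punchIn last k)
      (subst (λ m → suc n ≤ suc (toℕ i + m)) (sym (toℕ-punchIn-last k)) (s≤s n≤i+k))
    p∤anti′ : ∀ i k → suc (toℕ i + toℕ k) ≡ n → ¬ p ∣ ∣ minor M last i k ∣
    p∤anti′ i k i+k≡ = p∤anti (suc i) (punchIn last k)
      (cong suc (trans (cong (λ m → suc (toℕ i + m)) (toℕ-punchIn-last k)) i+k≡))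

-- Coefficients of (x^r - 1)^e and (x^r - x - 1)^e

≢0-by-contradiction : ∀ {x : ℤ} → ¬ x ≢ ℤ.0ℤ → x ≡ ℤ.0ℤ
≢0-by-contradiction {x} = decidable-stable (x ℤ.≟ ℤ.0ℤ)

i-j≢0 : ∀ i j → i ℤ.- j ≢ ℤ.0ℤ → i ≢ ℤ.0ℤ ⊎ j ≢ ℤ.0ℤ
i-j≢0 i j i-j≢0 with i ℤ.≟ ℤ.0ℤ
... | no  i≢0 = inj₁ i≢0
... | yes refl = inj₂ λ { refl → i-j≢0 refl }

shift : ℕ → (ℕ → ℤ) → ℕ → ℤ
shift zero    h n       = h n
shift (suc k) h zero    = ℤ.0ℤ
shift (suc k) h (suc n) = shift k h n

shift-+ : ∀ k h n → shift k h (k + n) ≡ h n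
shift-+ zero    h n = refl
shift-+ (suc k) h n = shift-+ k h n

shift-< : ∀ k h n → n < k → shift k h n ≡ ℤ.0ℤ
shift-< (suc k) h zero    _         = refl
shift-< (suc k) h (suc n) (s≤s n<k) = shift-< k h n n<k

shift-zeros : ∀ k n → shift k (λ _ → ℤ.0ℤ) n ≡ ℤ.0ℤ
shift-zeros zero    n       = refl
shift-zeros (suc k) zero    = refl
shift-zeros (suc k) (suc n) = shift-zeros k n

shift-support : ∀ k h n → shift k h n ≢ ℤ.0ℤ → ∃ λ m → n ≡ k + m × h m ≢ ℤ.0ℤ
shift-support zero    h n       hₙ≢0 = n , refl , hₙ≢0
shift-support (suc k) h zero    0≢0 = contradiction refl 0≢0
shift-support (suc k) h (suc n) nz with shift-support k h n nz
... | m , refl , hₘ≢0 = m , refl , hₘ≢0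

coeff-⊕ : ∀ f g n → coeff (f ⊕ g) n ≡ coeff f n ℤ.+ coeff g n
coeff-⊕ []      g       n       = sym (ℤP.+-identityˡ _)
coeff-⊕ (a ∷ f) []      n       = sym (ℤP.+-identityʳ _)
coeff-⊕ (a ∷ f) (b ∷ g) zero    = refl
coeff-⊕ (a ∷ f) (b ∷ g) (suc n) = coeff-⊕ f g n

coeff-map-* : ∀ a g n → coeff (map (a ℤ.*_) g) n ≡ a ℤ.* coeff g n
coeff-map-* a []      n       = sym (ℤP.*-zeroʳ a)
coeff-map-* a (b ∷ g) zero    = refl
coeff-map-* a (b ∷ g) (suc n) = coeff-map-* a g n

coeff-0∷ : ∀ h n → coeff (ℤ.0ℤ ∷ h) n ≡ shift 1 (coeff h) n
coeff-0∷ h zero    = refl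
coeff-0∷ h (suc n) = refl

coeff-∷⊗ : ∀ a f g n → coeff ((a ∷ f) ⊗ g) n ≡ a ℤ.* coeff g n ℤ.+ shift 1 (coeff (f ⊗ g)) n
coeff-∷⊗ a f g n =
  trans (coeff-⊕ (map (a ℤ.*_) g) (ℤ.0ℤ ∷ (f ⊗ g)) n) (cong₂ ℤ._+_ (coeff-map-* a g n) (coeff-0∷ (f ⊗ g) n))

coeff-monomial⊗ : ∀ k c g n → coeff (monomial k c ⊗ g) n ≡ c ℤ.* shift k (coeff g) n
coeff-monomial⊗ zero    c g n       =
  trans (coeff-∷⊗ c [] g n) (trans (cong (λ x → c ℤ.* coeff g n ℤ.+ x) (shift-zeros 1 n)) (ℤP.+-identityʳ _))
coeff-monomial⊗ (suc k) c g zero    = trans (coeff-∷⊗ ℤ.0ℤ (monomial k c) g zero) (sym (ℤP.*-zeroʳ c))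
coeff-monomial⊗ (suc k) c g (suc n) =
  trans (coeff-∷⊗ ℤ.0ℤ (monomial k c) g (suc n)) (trans (ℤP.+-identityˡ _) (coeff-monomial⊗ k c g n))

coeff-⊕⊗ : ∀ f f′ g n → coeff ((f ⊕ f′) ⊗ g) n ≡ coeff (f ⊗ g) n ℤ.+ coeff (f′ ⊗ g) n
coeff-⊕⊗ []      f′       g n = sym (ℤP.+-identityˡ _)
coeff-⊕⊗ (a ∷ f) []       g n = sym (ℤP.+-identityʳ _)
coeff-⊕⊗ (a ∷ f) (b ∷ f′) g n = begin
  coeff (((a ℤ.+ b) ∷ (f ⊕ f′)) ⊗ g) n
    ≡⟨ coeff-∷⊗ (a ℤ.+ b) (f ⊕ f′) g n ⟩
  (a ℤ.+ b) ℤ.* coeff g n ℤ.+ shift 1 (coeff ((f ⊕ f′) ⊗ g)) n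
    ≡⟨ cong (λ x → (a ℤ.+ b) ℤ.* coeff g n ℤ.+ x) (shift1-⊕⊗ n) ⟩
  (a ℤ.+ b) ℤ.* coeff g n ℤ.+ (shift 1 (coeff (f ⊗ g)) n ℤ.+ shift 1 (coeff (f′ ⊗ g)) n)
    ≡⟨ distrib a b (coeff g n) _ _ ⟩
  (a ℤ.* coeff g n ℤ.+ shift 1 (coeff (f ⊗ g)) n) ℤ.+ (b ℤ.* coeff g n ℤ.+ shift 1 (coeff (f′ ⊗ g)) n)
    ≡⟨ cong₂ ℤ._+_ (coeff-∷⊗ a f g n) (coeff-∷⊗ b f′ g n) ⟨
  coeff ((a ∷ f) ⊗ g) n ℤ.+ coeff ((b ∷ f′) ⊗ g) n
    ∎
  where
  open ≡-Reasoning
  distrib : ∀ a b x y z → (a ℤ.+ b) ℤ.* x ℤ.+ (y ℤ.+ z) ≡ (a ℤ.* x ℤ.+ y) ℤ.+ (b ℤ.* x ℤ.+ z)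
  distrib = ℤ-Ring.solve-∀
  shift1-⊕⊗ : ∀ n → shift 1 (coeff ((f ⊕ f′) ⊗ g)) n ≡ shift 1 (coeff (f ⊗ g)) n ℤ.+ shift 1 (coeff (f′ ⊗ g)) n
  shift1-⊕⊗ zero    = refl
  shift1-⊕⊗ (suc n) = coeff-⊕⊗ f f′ g n

coeff-binomial^suc : ∀ r e n → let c = coeff (binomial r ^ᴾ e) in
                     coeff (binomial r ^ᴾ suc e) n ≡ shift r c n ℤ.- c n
coeff-binomial^suc r e n = begin
  coeff ((monomial r ℤ.1ℤ ⊕ monomial 0 ℤ.-1ℤ) ⊗ G) n
    ≡⟨ coeff-⊕⊗ (monomial r ℤ.1ℤ) (monomial 0 ℤ.-1ℤ) G n ⟩
  coeff (monomial r ℤ.1ℤ ⊗ G) n ℤ.+ coeff (monomial 0 ℤ.-1ℤ ⊗ G) n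
    ≡⟨ cong₂ ℤ._+_ (coeff-monomial⊗ r ℤ.1ℤ G n) (coeff-monomial⊗ 0 ℤ.-1ℤ G n) ⟩
  ℤ.1ℤ ℤ.* shift r (coeff G) n ℤ.+ ℤ.-1ℤ ℤ.* coeff G n
    ≡⟨ normalise (shift r (coeff G) n) (coeff G n) ⟩
  shift r (coeff G) n ℤ.- coeff G n
    ∎
  where
  open ≡-Reasoning
  G : Poly
  G = binomial r ^ᴾ e
  normalise : ∀ x z → ℤ.1ℤ ℤ.* x ℤ.+ ℤ.-1ℤ ℤ.* z ≡ x ℤ.- z
  normalise = ℤ-Ring.solve-∀

coeff-trinomial^suc : ∀ r e n → let c = coeff (trinomial r ^ᴾ e) in
                      coeff (trinomial r ^ᴾ suc e) n ≡ shift r c n ℤ.- shift 1 c n ℤ.- c n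
coeff-trinomial^suc r e n = begin
  coeff ((monomial r ℤ.1ℤ ⊕ (monomial 1 ℤ.-1ℤ ⊕ monomial 0 ℤ.-1ℤ)) ⊗ G) n
    ≡⟨ coeff-⊕⊗ (monomial r ℤ.1ℤ) (monomial 1 ℤ.-1ℤ ⊕ monomial 0 ℤ.-1ℤ) G n ⟩
  coeff (monomial r ℤ.1ℤ ⊗ G) n ℤ.+ coeff ((monomial 1 ℤ.-1ℤ ⊕ monomial 0 ℤ.-1ℤ) ⊗ G) n
    ≡⟨ cong (λ x → coeff (monomial r ℤ.1ℤ ⊗ G) n ℤ.+ x) (coeff-⊕⊗ (monomial 1 ℤ.-1ℤ) (monomial 0 ℤ.-1ℤ) G n) ⟩
  coeff (monomial r ℤ.1ℤ ⊗ G) n ℤ.+ (coeff (monomial 1 ℤ.-1ℤ ⊗ G) n ℤ.+ coeff (monomial 0 ℤ.-1ℤ ⊗ G) n)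
    ≡⟨ cong₂ ℤ._+_ (coeff-monomial⊗ r ℤ.1ℤ G n)
                   (cong₂ ℤ._+_ (coeff-monomial⊗ 1 ℤ.-1ℤ G n) (coeff-monomial⊗ 0 ℤ.-1ℤ G n)) ⟩
  ℤ.1ℤ ℤ.* shift r (coeff G) n ℤ.+ (ℤ.-1ℤ ℤ.* shift 1 (coeff G) n ℤ.+ ℤ.-1ℤ ℤ.* coeff G n)
    ≡⟨ normalise (shift r (coeff G) n) (shift 1 (coeff G) n) (coeff G n) ⟩
  shift r (coeff G) n ℤ.- shift 1 (coeff G) n ℤ.- coeff G n
    ∎
  where
  open ≡-Reasoning
  G : Poly
  G = trinomial r ^ᴾ e
  normalise : ∀ x y z → ℤ.1ℤ ℤ.* x ℤ.+ (ℤ.-1ℤ ℤ.* y ℤ.+ ℤ.-1ℤ ℤ.* z) ≡ x ℤ.- y ℤ.- z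
  normalise = ℤ-Ring.solve-∀

coeff-1∷[]-support : ∀ n → coeff (ℤ.1ℤ ∷ []) n ≢ ℤ.0ℤ → n ≡ 0
coeff-1∷[]-support zero    _   = refl
coeff-1∷[]-support (suc n) 0≢0 = contradiction refl 0≢0

binomial^-support : ∀ r e n → coeff (binomial r ^ᴾ e) n ≢ ℤ.0ℤ → ∃ λ a → a ≤ e × n ≡ a * r
binomial^-support r zero    n cₙ≢0 = 0 , z≤n , coeff-1∷[]-support n cₙ≢0
binomial^-support r (suc e) n cₙ≢0
  with i-j≢0 _ _ (subst (_≢ ℤ.0ℤ) (coeff-binomial^suc r e n) cₙ≢0)
... | inj₁ shifted≢0 with shift-support r _ n shifted≢0
...   | m , refl , cₘ≢0 with binomial^-support r e m cₘ≢0
...     | a , a≤e , refl = suc a , s≤s a≤e , refl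
binomial^-support r (suc e) n cₙ≢0 | inj₂ cₙ≢0′ with binomial^-support r e n cₙ≢0′
... | a , a≤e , n≡ar = a , m≤n⇒m≤1+n a≤e , n≡ar

trinomial^-support : ∀ r e n → coeff (trinomial r ^ᴾ e) n ≢ ℤ.0ℤ → ∃₂ λ a m → a + m ≤ e × n ≡ a * r + m
trinomial^-support r zero    n cₙ≢0 = 0 , 0 , z≤n , coeff-1∷[]-support n cₙ≢0
trinomial^-support r (suc e) n cₙ≢0
  with i-j≢0 _ _ (subst (_≢ ℤ.0ℤ) (coeff-trinomial^suc r e n) cₙ≢0)
... | inj₂ cₙ≢0′ with trinomial^-support r e n cₙ≢0′
...   | a , m , a+m≤e , n≡ = a , m , m≤n⇒m≤1+n a+m≤e , n≡
trinomial^-support r (suc e) n cₙ≢0 | inj₁ diff≢0 with i-j≢0 _ _ diff≢0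
... | inj₁ shiftedʳ≢0 with shift-support r _ n shiftedʳ≢0
...   | n′ , refl , c≢0 with trinomial^-support r e n′ c≢0
...     | a , m , a+m≤e , refl = suc a , m , s≤s a+m≤e , sym (+-assoc r (a * r) m)
trinomial^-support r (suc e) n cₙ≢0 | inj₁ diff≢0 | inj₂ shifted¹≢0 with shift-support 1 _ n shifted¹≢0
... | n′ , refl , c≢0 with trinomial^-support r e n′ c≢0
...   | a , m , a+m≤e , refl =
  a , suc m , subst (_≤ suc e) (sym (+-suc a m)) (s≤s a+m≤e) , sym (+-suc (a * r) m)

signedChoose : ℕ → ℕ → ℤ
signedChoose n k = ℤ.-1ℤ ℤ.^ (n ∸ k) ℤ.* + (n C k)

∸≡suc∸suc : ∀ {m n} → m < n → n ∸ m ≡ suc (n ∸ suc m)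
∸≡suc∸suc {zero}  {suc n} _         = refl
∸≡suc∸suc {suc m} {suc n} (s≤s m<n) = ∸≡suc∸suc m<n

-- stated with the sign (-1)^(n ∸ k), so that it also holds (as 0 = 0) when n ≤ k
signedChoose-suc : ∀ n k → signedChoose n (suc k) ≡ ℤ.- (ℤ.-1ℤ ℤ.^ (n ∸ k) ℤ.* + (n C suc k))
signedChoose-suc n k with k <? n
... | yes k<n = begin
  s ℤ.* + (n C suc k)                           ≡⟨ flip s (+ (n C suc k)) ⟩
  ℤ.- (ℤ.-1ℤ ℤ.* s ℤ.* + (n C suc k))          ≡⟨ cong (λ m → ℤ.- (ℤ.-1ℤ ℤ.^ m ℤ.* + (n C suc k))) (∸≡suc∸suc k<n) ⟨
  ℤ.- (ℤ.-1ℤ ℤ.^ (n ∸ k) ℤ.* + (n C suc k))    ∎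
  where
  open ≡-Reasoning
  s : ℤ
  s = ℤ.-1ℤ ℤ.^ (n ∸ suc k)
  flip : ∀ s c → s ℤ.* c ≡ ℤ.- (ℤ.-1ℤ ℤ.* s ℤ.* c)
  flip = ℤ-Ring.solve-∀
... | no  k≮n rewrite k>n⇒nCk≡0 (s≤s (≮⇒≥ k≮n)) =
  trans (ℤP.*-zeroʳ (ℤ.-1ℤ ℤ.^ (n ∸ suc k))) (sym (cong ℤ.-_ (ℤP.*-zeroʳ (ℤ.-1ℤ ℤ.^ (n ∸ k)))))

signedChoose-pascal : ∀ n k → signedChoose n k ℤ.- signedChoose n (suc k) ≡ signedChoose (suc n) (suc k)
signedChoose-pascal n k = begin
  s ℤ.* + (n C k) ℤ.- signedChoose n (suc k)          ≡⟨ cong (λ x → s ℤ.* + (n C k) ℤ.- x) (signedChoose-suc n k) ⟩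
  s ℤ.* + (n C k) ℤ.- ℤ.- (s ℤ.* + (n C suc k))       ≡⟨ factor s (+ (n C k)) (+ (n C suc k)) ⟩
  s ℤ.* (+ (n C k) ℤ.+ + (n C suc k))                 ≡⟨ cong (s ℤ.*_) (ℤP.pos-+ (n C k) (n C suc k)) ⟨
  s ℤ.* + (n C k + n C suc k)                         ≡⟨ cong (λ c → s ℤ.* + c) (nCk+nC[k+1]≡[n+1]C[k+1] n k) ⟩
  s ℤ.* + (suc n C suc k)                             ∎
  where
  open ≡-Reasoning
  s : ℤ
  s = ℤ.-1ℤ ℤ.^ (n ∸ k)
  factor : ∀ s a b → s ℤ.* a ℤ.- ℤ.- (s ℤ.* b) ≡ s ℤ.* (a ℤ.+ b)
  factor = ℤ-Ring.solve-∀

signedChoose-suc-0 : ∀ n → signedChoose (suc n) 0 ≡ ℤ.0ℤ ℤ.- signedChoose n 0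
signedChoose-suc-0 n = negate (ℤ.-1ℤ ℤ.^ n)
  where
  negate : ∀ s → ℤ.-1ℤ ℤ.* s ℤ.* ℤ.1ℤ ≡ ℤ.0ℤ ℤ.- s ℤ.* ℤ.1ℤ
  negate = ℤ-Ring.solve-∀

prime∤signedChoose : ∀ {p} → Prime p → ∀ {n k} → n < p → k ≤ n → ¬ p ∣ ∣ signedChoose n k ∣
prime∤signedChoose pp {n} {k} n<p k≤n =
  subst (λ m → ¬ _ ∣ m) (sym (∣-1^n*i∣≡∣i∣ (n ∸ k) (+ (n C k)))) (prime∤C pp n<p k≤n)

coeff-binomial^ : ∀ r → .{{NonZero r}} → ∀ e a → coeff (binomial r ^ᴾ e) (a * r) ≡ signedChoose e a
coeff-binomial^ (suc r) zero    zero    = refl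
coeff-binomial^ (suc r) zero    (suc a) = refl
coeff-binomial^ r@(suc _) (suc e) zero = begin
  coeff (binomial r ^ᴾ suc e) 0   ≡⟨ coeff-binomial^suc r e 0 ⟩
  ℤ.0ℤ ℤ.- c 0                    ≡⟨ cong (λ x → ℤ.0ℤ ℤ.- x) (coeff-binomial^ r e 0) ⟩
  ℤ.0ℤ ℤ.- signedChoose e 0       ≡⟨ signedChoose-suc-0 e ⟨
  signedChoose (suc e) 0          ∎
  where
  open ≡-Reasoning
  c : ℕ → ℤ
  c = coeff (binomial r ^ᴾ e)
coeff-binomial^ r@(suc _) (suc e) (suc a) = begin
  coeff (binomial r ^ᴾ suc e) (r + a * r)        ≡⟨ coeff-binomial^suc r e (r + a * r) ⟩
  shift r c (r + a * r) ℤ.- c (suc a * r)         ≡⟨ cong₂ ℤ._-_ (shift-+ r c (a * r)) (coeff-binomial^ r e (suc a)) ⟩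
  c (a * r) ℤ.- signedChoose e (suc a)            ≡⟨ cong (ℤ._- signedChoose e (suc a)) (coeff-binomial^ r e a) ⟩
  signedChoose e a ℤ.- signedChoose e (suc a)     ≡⟨ signedChoose-pascal e a ⟩
  signedChoose (suc e) (suc a)                    ∎
  where
  open ≡-Reasoning
  c : ℕ → ℤ
  c = coeff (binomial r ^ᴾ e)

coeff-trinomial^≡0 : ∀ {r e} a m → e < r → m < r → e < a + m → coeff (trinomial r ^ᴾ e) (a * r + m) ≡ ℤ.0ℤ
coeff-trinomial^≡0 {r} {e} a m e<r m<r e<a+m = ≢0-by-contradiction outsideSupport
  where
  outsideSupport : ¬ coeff (trinomial r ^ᴾ e) (a * r + m) ≢ ℤ.0ℤ
  outsideSupport c≢0 with trinomial^-support r e (a * r + m) c≢0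
  ... | a′ , m′ , a′+m′≤e , eq with quotRem-unique a a′ m<r (≤-<-trans (≤-trans (m≤n+m m′ a′) a′+m′≤e) e<r) eq
  ...   | refl , refl = <⇒≱ e<a+m a′+m′≤e

coeff-trinomial^ : ∀ r e → e < r → ∀ a → coeff (trinomial r ^ᴾ e) (a * r + (e ∸ a)) ≡ signedChoose e a
coeff-trinomial^ (suc r) zero    _   zero    = refl
coeff-trinomial^ (suc r) zero    _   (suc a) = refl
coeff-trinomial^ r       (suc e) e<r zero    = begin
  coeff (trinomial r ^ᴾ suc e) (suc e)              ≡⟨ coeff-trinomial^suc r e (suc e) ⟩
  shift r c (suc e) ℤ.- c e ℤ.- c (suc e)           ≡⟨ cong₂ (λ x y → x ℤ.- c e ℤ.- y) (shift-< r c (suc e) e<r)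
                                                         (coeff-trinomial^≡0 0 (suc e) e<r′ e<r (n<1+n e)) ⟩
  ℤ.0ℤ ℤ.- c e ℤ.- ℤ.0ℤ                             ≡⟨ ℤP.+-identityʳ _ ⟩
  ℤ.0ℤ ℤ.- c e                                      ≡⟨ cong (λ x → ℤ.0ℤ ℤ.- x) (coeff-trinomial^ r e e<r′ 0) ⟩
  ℤ.0ℤ ℤ.- signedChoose e 0                         ≡⟨ signedChoose-suc-0 e ⟨
  signedChoose (suc e) 0                            ∎
  where
  open ≡-Reasoning
  c : ℕ → ℤ
  c = coeff (trinomial r ^ᴾ e)
  e<r′ : e < r
  e<r′ = <-trans (n<1+n e) e<r
coeff-trinomial^ r@(suc r′) (suc e) e<r (suc a) = begin
  c′ n                                              ≡⟨ coeff-trinomial^suc r e n ⟩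
  shift r c n ℤ.- shift 1 c n ℤ.- c n               ≡⟨ cong₂ (λ x y → x ℤ.- shift 1 c n ℤ.- y) shiftʳ≡ cₙ≡0 ⟩
  signedChoose e a ℤ.- shift 1 c n ℤ.- ℤ.0ℤ         ≡⟨ ℤP.+-identityʳ _ ⟩
  signedChoose e a ℤ.- shift 1 c n                  ≡⟨ cong (λ x → signedChoose e a ℤ.- x) shift¹≡ ⟩
  signedChoose e a ℤ.- signedChoose e (suc a)       ≡⟨ signedChoose-pascal e a ⟩
  signedChoose (suc e) (suc a)                      ∎
  where
  open ≡-Reasoning
  c′ : ℕ → ℤ
  c′ = coeff (trinomial r ^ᴾ suc e)
  c : ℕ → ℤ
  c = coeff (trinomial r ^ᴾ e)
  n : ℕ
  n = suc a * r + (e ∸ a)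
  e<r′ : e < r
  e<r′ = <-trans (n<1+n e) e<r
  shiftʳ≡ : shift r c n ≡ signedChoose e a
  shiftʳ≡ = trans (cong (shift r c) (+-assoc r (a * r) (e ∸ a)))
                  (trans (shift-+ r c (a * r + (e ∸ a))) (coeff-trinomial^ r e e<r′ a))
  cₙ≡0 : c n ≡ ℤ.0ℤ
  cₙ≡0 = coeff-trinomial^≡0 (suc a) (e ∸ a) e<r′ (≤-<-trans (m∸n≤m e a) e<r′) (s≤s (m≤n+m∸n e a))
  shift¹≡ : shift 1 c n ≡ signedChoose e (suc a)
  shift¹≡ with a <? e
  ... | yes a<e = trans (cong (shift 1 c) n≡suc) (coeff-trinomial^ r e e<r′ (suc a))
    where
    n≡suc : n ≡ suc (suc a * r + (e ∸ suc a))
    n≡suc = trans (cong (λ m → suc a * r + m) (∸≡suc∸suc a<e)) (+-suc (suc a * r) (e ∸ suc a))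
  ... | no  a≮e = trans (cong (shift 1 c) n≡suc) (trans cₐᵣ₊ᵣ′≡0 (sym choose≡0))
    where
    e≤a : e ≤ a
    e≤a = ≮⇒≥ a≮e
    n≡suc : n ≡ suc (a * r + r′)
    n≡suc = trans (cong (λ m → suc a * r + m) (m≤n⇒m∸n≡0 e≤a)) (trans (+-identityʳ _) (cong suc (+-comm r′ (a * r))))
    cₐᵣ₊ᵣ′≡0 : c (a * r + r′) ≡ ℤ.0ℤ
    cₐᵣ₊ᵣ′≡0 = coeff-trinomial^≡0 a r′ e<r′ (n<1+n r′) (≤-<-trans e≤a (m<m+n a (≤-<-trans z≤n (s≤s⁻¹ e<r))))
    choose≡0 : signedChoose e (suc a) ≡ ℤ.0ℤ
    choose≡0 = trans (cong (λ m → ℤ.-1ℤ ℤ.^ (e ∸ suc a) ℤ.* + m) (k>n⇒nCk≡0 (s≤s e≤a))) (ℤP.*-zeroʳ (ℤ.-1ℤ ℤ.^ (e ∸ suc a)))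

Mat-index : ∀ p d i j → d ≤ p → (suc i * p + suc j) ∸ (d + 1) ≡ i * p + (p ∸ d) + j
Mat-index p d i j d≤p = begin
  (suc i * p + suc j) ∸ (d + 1)              ≡⟨ cong (λ q → (suc i * q + suc j) ∸ (d + 1)) p≡k+d ⟩
  (suc i * (k + d) + suc j) ∸ (d + 1)        ≡⟨ cong (_∸ (d + 1)) (rearrange i j k d) ⟨
  i * (k + d) + k + j + (d + 1) ∸ (d + 1)    ≡⟨ m+n∸n≡m _ (d + 1) ⟩
  i * (k + d) + k + j                        ≡⟨ cong (λ q → i * q + k + j) p≡k+d ⟨
  i * p + k + j                              ∎
  where
  open ≡-Reasoning
  k : ℕ
  k = p ∸ d
  p≡k+d : p ≡ k + d
  p≡k+d = sym (m∸n+n≡m d≤p)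
  rearrange : ∀ i j k d → i * (k + d) + k + j + (d + 1) ≡ suc i * (k + d) + suc j
  rearrange = ℕ-Ring.solve-∀

Mat-entry : ∀ p F e d (i j : Fin d) → d ≤ p → Mat p F e d i j ≡ coeff (F ^ᴾ e) (toℕ i * p + (p ∸ d) + toℕ j)
Mat-entry p F e d i j d≤p = cong (coeff (F ^ᴾ e)) (Mat-index p d (toℕ i) (toℕ j) d≤p)

p∸d+j<p : ∀ {p d j} → d ≤ p → j < d → p ∸ d + j < p
p∸d+j<p {p} {d} {j} d≤p j<d = subst (p ∸ d + j <_) (m∸n+n≡m d≤p) (+-monoʳ-< (p ∸ d) j<d)

detNonzero⇒row≢0 : ∀ {p F e d} → d ≤ p → detNonzero p F e d → ∀ {i} → i < d →
                   ∃ λ j → j < d × coeff (F ^ᴾ e) (i * p + (p ∸ d) + j) ≢ ℤ.0ℤ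
detNonzero⇒row≢0 {p} {F} {e} {d} d≤p det≢0 {i} i<d
  with Fin.¬∀⟶∃¬ d (λ j → M row j ≡ ℤ.0ℤ) (λ j → M row j ℤ.≟ ℤ.0ℤ) rowNotZero
  where
  M : Matrix d
  M = Mat p F e d
  row : Fin d
  row = fromℕ< i<d
  rowNotZero : ¬ (∀ j → M row j ≡ ℤ.0ℤ)
  rowNotZero row≡0 = det≢0 (subst (λ x → p ∣ ∣ x ∣) (sym (det-zeroRow d M row row≡0)) (divides 0 refl))
... | j , Mᵢⱼ≢0 = toℕ j , Fin.toℕ<n j , λ c≡0 →
  Mᵢⱼ≢0 (trans (Mat-entry p F e d (fromℕ< i<d) j d≤p) (subst (λ m → coeff (F ^ᴾ e) (m * p + (p ∸ d) + toℕ j) ≡ ℤ.0ℤ)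
                                               (sym (Fin.toℕ-fromℕ< i<d)) c≡0))

detNonzero-binomial⇒row : ∀ {p r e d} → d ≤ p → detNonzero p (binomial r) e d → ∀ {i} → i < d →
                          ∃₂ λ j a → j < d × a ≤ e × i * p + (p ∸ d) + j ≡ a * r
detNonzero-binomial⇒row {r = r} {e} d≤p det≢0 i<d with detNonzero⇒row≢0 {F = binomial r} {e} d≤p det≢0 i<d
... | j , j<d , c≢0 with binomial^-support r e _ c≢0
...   | a , a≤e , eq = j , a , j<d , a≤e , eq

detNonzero-trinomial⇒row : ∀ {p r e d} → d ≤ p → detNonzero p (trinomial r) e d → ∀ {i} → i < d →
                           ∃₂ λ j a → ∃ λ m → j < d × a + m ≤ e × i * p + (p ∸ d) + j ≡ a * r + m
detNonzero-trinomial⇒row {r = r} {e} d≤p det≢0 i<d with detNonzero⇒row≢0 {F = trinomial r} {e} d≤p det≢0 i<d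
... | j , j<d , c≢0 with trinomial^-support r e _ c≢0
...   | a , m , a+m≤e , eq = j , a , m , j<d , a+m≤e , eq

Mat-index-rowEnd : ∀ {p D j} i → D ≤ p → j < D → i * p + (p ∸ D) + j + (pred D ∸ j) ≡ i * p + (p ∸ 1)
Mat-index-rowEnd {p} {D@(suc D′)} {j} i D≤p j<D = begin
  i * p + (p ∸ D) + j + (D′ ∸ j)    ≡⟨ +-assoc (i * p + (p ∸ D)) j (D′ ∸ j) ⟩
  i * p + (p ∸ D) + (j + (D′ ∸ j))  ≡⟨ cong (_+_ (i * p + (p ∸ D))) (m+[n∸m]≡n (s≤s⁻¹ j<D)) ⟩
  i * p + (p ∸ D) + D′              ≡⟨ +-assoc (i * p) (p ∸ D) D′ ⟩
  i * p + (p ∸ D + D′)              ≡⟨ cong (λ k → i * p + pred k) (+-suc (p ∸ D) D′) ⟨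
  i * p + pred (p ∸ D + D)          ≡⟨ cong (λ k → i * p + pred k) (m∸n+n≡m D≤p) ⟩
  i * p + (p ∸ 1)                   ∎
  where open ≡-Reasoning

multipleInRow⇒rowResidue : ∀ {p R D i j} a .{{_ : NonZero R}} → D ≤ R → D ≤ p → j < D →
                           i * p + (p ∸ D) + j ≡ a * R → (i * p + (p ∸ 1)) % R ≡ pred D ∸ j
multipleInRow⇒rowResidue {p} {R} {D@(suc D′)} {i} {j} a D≤R D≤p j<D row≡ = begin
  (i * p + (p ∸ 1)) % R                   ≡⟨ cong (_% R) (Mat-index-rowEnd i D≤p j<D) ⟨
  (i * p + (p ∸ D) + j + (D′ ∸ j)) % R    ≡⟨ cong (λ k → (k + (D′ ∸ j)) % R) row≡ ⟩
  (a * R + (D′ ∸ j)) % R                  ≡⟨ cong (_% R) (+-comm (a * R) (D′ ∸ j)) ⟩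
  (D′ ∸ j + a * R) % R                    ≡⟨ [m+kn]%n≡m%n (D′ ∸ j) a R ⟩
  (D′ ∸ j) % R                            ≡⟨ m<n⇒m%n≡m (<-≤-trans (s≤s (m∸n≤m D′ j)) D≤R) ⟩
  D′ ∸ j                                  ∎
  where open ≡-Reasoning

rowResidue-step : ∀ p R .{{_ : NonZero R}} i → (suc i * p + (p ∸ 1)) % R ≡ ((i * p + (p ∸ 1)) % R + p % R) % R
rowResidue-step p R i =
  trans (cong (_% R) (trans (+-assoc p (i * p) (p ∸ 1)) (+-comm p (i * p + (p ∸ 1)))))
        (%-distribˡ-+ (i * p + (p ∸ 1)) p R)

-- 𝒰(p) and 𝓑(p) on natural numbers

record InUℕ (p R E D : ℕ) : Set where
  field
    2≤R        : 2 ≤ R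
    1≤E        : 1 ≤ E
    E≤p∸1      : E ≤ p ∸ 1
    1≤D        : 1 ≤ D
    D≤p        : D ≤ p
    D[p∸1]≤RE  : D * (p ∸ 1) ≤ R * E
    g          : ℕ
    g>0        : g > 0
    g-equation : g * (R * (R ∸ 1)) + D * (D + 1) * (p ∸ 1) ≡ 2 * R * E * D
    g-even     : p ≢ 2 → 2 ∣ g

InB₊ℕ InB₀ℕ InB₋ℕ InBℕ : ℕ → ℕ → ℕ → ℕ → Set
InB₊ℕ p R E D = 2 ≤ R × R ≤ p × E ≡ p ∸ 1 × D ≡ R
InB₀ℕ p R E D = 2 ≤ R × R ≤ p + 1 × p ∸ 1 < 2 * E × E ≤ p ∸ 1 × R * (p ∸ 1 ∸ E) ≤ p ∸ 1 × D ≡ R ∸ 1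
InB₋ℕ p R E D = 2 ≤ R × p ∸ 1 < 2 * E × E ≤ p ∸ 1 × R * (p ∸ 1 ∸ E) ≡ p ∸ 1 × D ≡ R ∸ 2
InBℕ  p R E D = InB₊ℕ p R E D ⊎ InB₀ℕ p R E D ⊎ InB₋ℕ p R E D

InB₊ℕ⊎InB₀ℕ⇒D≤R≤1+D : ∀ {p R E D} → InB₊ℕ p R E D ⊎ InB₀ℕ p R E D → D ≤ R × R ≤ suc D
InB₊ℕ⊎InB₀ℕ⇒D≤R≤1+D {R = R} (inj₁ (_ , _ , _ , refl)) = ≤-refl , n≤1+n R
InB₊ℕ⊎InB₀ℕ⇒D≤R≤1+D {R = suc R′} (inj₂ (_ , _ , _ , _ , _ , refl)) = n≤1+n R′ , ≤-refl

+m-+n≡+[m∸n] : ∀ {m n} → n ≤ m → + m ℤ.- + n ≡ + (m ∸ n)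
+m-+n≡+[m∸n] {m} {n} n≤m = trans (ℤP.[+m]-[+n]≡m⊖n m n) (ℤP.⊖-≥ n≤m)

+m≡+n-+o⇔m+o≡n : ∀ m n o → (+ m ≡ + n ℤ.- + o) ⇔ (m + o ≡ n)
+m≡+n-+o⇔m+o≡n m n o = mk⇔
  (λ m≡n-o → ℤP.+-injective (trans (ℤP.pos-+ m o) (trans (cong (ℤ._+ + o) m≡n-o) (cancel (+ n) (+ o)))))
  (λ { refl → trans (sym (cancel′ (+ m) (+ o))) (cong (ℤ._- + o) (sym (ℤP.pos-+ m o))) })
  where
  cancel : ∀ x y → x ℤ.- y ℤ.+ y ≡ x
  cancel = ℤ-Ring.solve-∀
  cancel′ : ∀ x y → x ℤ.+ y ℤ.- y ≡ x
  cancel′ = ℤ-Ring.solve-∀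

+a*+b≤+c*+d⇔ : ∀ a b c d → (+ a ℤ.* + b ℤ.≤ + c ℤ.* + d) ⇔ (a * b ≤ c * d)
+a*+b≤+c*+d⇔ a b c d = mk⇔
  (λ ab≤cd → ℤP.drop‿+≤+ (subst₂ ℤ._≤_ (sym (ℤP.pos-* a b)) (sym (ℤP.pos-* c d)) ab≤cd))
  (λ ab≤cd → subst₂ ℤ._≤_ (ℤP.pos-* a b) (ℤP.pos-* c d) (ℤ.+≤+ ab≤cd))

module _ {p : ℕ} .{{_ : NonZero p}} where

  +p-1≡+[p∸1] : + p ℤ.- ℤ.1ℤ ≡ + (p ∸ 1)
  +p-1≡+[p∸1] = +m-+n≡+[m∸n] (ℕ.>-nonZero⁻¹ p)

  g-equationℤ⇔ℕ : ∀ g R E D → 1 ≤ R →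
    (+ g ℤ.* (+ R ℤ.* (+ R ℤ.- ℤ.1ℤ)) ≡ + 2 ℤ.* + R ℤ.* + E ℤ.* + D ℤ.- + D ℤ.* (+ D ℤ.+ ℤ.1ℤ) ℤ.* (+ p ℤ.- ℤ.1ℤ))
    ⇔ (g * (R * (R ∸ 1)) + D * (D + 1) * (p ∸ 1) ≡ 2 * R * E * D)
  g-equationℤ⇔ℕ g R E D 1≤R = mk⇔
    (λ eqℤ → Equivalence.to (+m≡+n-+o⇔m+o≡n _ _ _) (trans (sym lhs) (trans eqℤ rhs)))
    (λ eqℕ → trans lhs (trans (Equivalence.from (+m≡+n-+o⇔m+o≡n _ _ _) eqℕ) (sym rhs)))
    where
    open ≡-Reasoning
    lhs : + g ℤ.* (+ R ℤ.* (+ R ℤ.- ℤ.1ℤ)) ≡ + (g * (R * (R ∸ 1)))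
    lhs = begin
      + g ℤ.* (+ R ℤ.* (+ R ℤ.- ℤ.1ℤ)) ≡⟨ cong (λ x → + g ℤ.* (+ R ℤ.* x)) (+m-+n≡+[m∸n] 1≤R) ⟩
      + g ℤ.* (+ R ℤ.* + (R ∸ 1))       ≡⟨ cong (+ g ℤ.*_) (ℤP.pos-* R (R ∸ 1)) ⟨
      + g ℤ.* + (R * (R ∸ 1))           ≡⟨ ℤP.pos-* g (R * (R ∸ 1)) ⟨
      + (g * (R * (R ∸ 1)))             ∎
    rhs : + 2 ℤ.* + R ℤ.* + E ℤ.* + D ℤ.- + D ℤ.* (+ D ℤ.+ ℤ.1ℤ) ℤ.* (+ p ℤ.- ℤ.1ℤ)
          ≡ + (2 * R * E * D) ℤ.- + (D * (D + 1) * (p ∸ 1))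
    rhs = begin
      + 2 ℤ.* + R ℤ.* + E ℤ.* + D ℤ.- + D ℤ.* + (D + 1) ℤ.* (+ p ℤ.- ℤ.1ℤ)
        ≡⟨ cong (λ x → + 2 ℤ.* + R ℤ.* + E ℤ.* + D ℤ.- + D ℤ.* + (D + 1) ℤ.* x) +p-1≡+[p∸1] ⟩
      + 2 ℤ.* + R ℤ.* + E ℤ.* + D ℤ.- + D ℤ.* + (D + 1) ℤ.* + (p ∸ 1)
        ≡⟨ cong₂ (λ x y → x ℤ.* + E ℤ.* + D ℤ.- y ℤ.* + (p ∸ 1)) (ℤP.pos-* 2 R) (ℤP.pos-* D (D + 1)) ⟨
      + (2 * R) ℤ.* + E ℤ.* + D ℤ.- + (D * (D + 1)) ℤ.* + (p ∸ 1)
        ≡⟨ cong₂ (λ x y → x ℤ.* + D ℤ.- y) (ℤP.pos-* (2 * R) E) (ℤP.pos-* (D * (D + 1)) (p ∸ 1)) ⟨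
      + (2 * R * E) ℤ.* + D ℤ.- + (D * (D + 1) * (p ∸ 1))
        ≡⟨ cong (ℤ._- + (D * (D + 1) * (p ∸ 1))) (ℤP.pos-* (2 * R * E) D) ⟨
      + (2 * R * E * D) ℤ.- + (D * (D + 1) * (p ∸ 1))
        ∎

  InU⇔InUℕ : ∀ R E D → InU p (+ R , + E , + D) ⇔ InUℕ p R E D
  InU⇔InUℕ R E D = mk⇔ to from
    where
    to : InU p (+ R , + E , + D) → InUℕ p R E D
    to (ℤ.+≤+ 2≤R , ℤ.+≤+ 1≤E , ℤ.+≤+ 1≤D , ℤ.+≤+ D≤p , DE , RE , + g , g-eq , ℤ.+<+ g>0 , g-even) = record
      { 2≤R        = 2≤R
      ; 1≤E        = 1≤E
      ; E≤p∸1      = *-cancelˡ-≤ R {{>-nonZero (<-trans z<s 2≤R)}}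
                       (Equivalence.to (+a*+b≤+c*+d⇔ R E R (p ∸ 1)) (subst (λ x → + R ℤ.* + E ℤ.≤ + R ℤ.* x) +p-1≡+[p∸1] RE))
      ; 1≤D        = 1≤D
      ; D≤p        = D≤p
      ; D[p∸1]≤RE  = Equivalence.to (+a*+b≤+c*+d⇔ D (p ∸ 1) R E) (subst (λ x → + D ℤ.* x ℤ.≤ + R ℤ.* + E) +p-1≡+[p∸1] DE)
      ; g          = g
      ; g>0        = g>0
      ; g-equation = Equivalence.to (g-equationℤ⇔ℕ g R E D (<-trans z<s 2≤R)) g-eq
      ; g-even     = g-even
      }
    from : InUℕ p R E D → InU p (+ R , + E , + D)
    from u = ℤ.+≤+ 2≤R , ℤ.+≤+ 1≤E , ℤ.+≤+ 1≤D , ℤ.+≤+ D≤p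
           , subst (λ x → + D ℤ.* x ℤ.≤ + R ℤ.* + E) (sym +p-1≡+[p∸1])
               (Equivalence.from (+a*+b≤+c*+d⇔ D (p ∸ 1) R E) D[p∸1]≤RE)
           , subst (λ x → + R ℤ.* + E ℤ.≤ + R ℤ.* x) (sym +p-1≡+[p∸1])
               (Equivalence.from (+a*+b≤+c*+d⇔ R E R (p ∸ 1)) (*-monoʳ-≤ R E≤p∸1))
           , + g , Equivalence.from (g-equationℤ⇔ℕ g R E D (<-trans z<s 2≤R)) g-equation , ℤ.+<+ g>0 , g-even
      where open InUℕ u

  +[p∸1]-+E≡ : ∀ {E} → E ≤ p ∸ 1 → + p ℤ.- ℤ.1ℤ ℤ.- + E ≡ + (p ∸ 1 ∸ E)
  +[p∸1]-+E≡ E≤p∸1 = trans (cong (ℤ._- _) +p-1≡+[p∸1]) (+m-+n≡+[m∸n] E≤p∸1)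

  p∸1<2E⇔ : ∀ E → (+ p ℤ.- ℤ.1ℤ ℤ.< + 2 ℤ.* + E) ⇔ (p ∸ 1 < 2 * E)
  p∸1<2E⇔ E = mk⇔
    (λ lt → ℤP.drop‿+<+ (subst₂ ℤ._<_ +p-1≡+[p∸1] (sym (ℤP.pos-* 2 E)) lt))
    (λ lt → subst₂ ℤ._<_ (sym +p-1≡+[p∸1]) (ℤP.pos-* 2 E) (ℤ.+<+ lt))

  +R*[p-1-E]≡ : ∀ R {E} → E ≤ p ∸ 1 → + R ℤ.* (+ p ℤ.- ℤ.1ℤ ℤ.- + E) ≡ + (R * (p ∸ 1 ∸ E))
  +R*[p-1-E]≡ R E≤p∸1 = trans (cong (+ R ℤ.*_) (+[p∸1]-+E≡ E≤p∸1)) (sym (ℤP.pos-* R _))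

  InB⇔InBℕ : ∀ R E D → InB p (+ R , + E , + D) ⇔ InBℕ p R E D
  InB⇔InBℕ R E D = mk⇔ to from
    where
    to : InB p (+ R , + E , + D) → InBℕ p R E D
    to (inj₁ (ℤ.+≤+ 2≤R , ℤ.+≤+ R≤p , e≡ , d≡)) =
      inj₁ (2≤R , R≤p , ℤP.+-injective (trans e≡ +p-1≡+[p∸1]) , ℤP.+-injective d≡)
    to (inj₂ (inj₁ (ℤ.+≤+ 2≤R , ℤ.+≤+ R≤p+1 , p∸1<2E , E≤ , R[p∸1∸E]≤ , d≡))) =
      inj₂ (inj₁ (2≤R , R≤p+1 , Equivalence.to (p∸1<2E⇔ E) p∸1<2E , E≤p∸1
                 , ℤP.drop‿+≤+ (subst₂ ℤ._≤_ (+R*[p-1-E]≡ R E≤p∸1) +p-1≡+[p∸1] R[p∸1∸E]≤)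
                 , ℤP.+-injective (trans d≡ (+m-+n≡+[m∸n] (<-trans z<s 2≤R)))))
      where
      E≤p∸1 : E ≤ p ∸ 1
      E≤p∸1 = ℤP.drop‿+≤+ (subst (+ E ℤ.≤_) +p-1≡+[p∸1] E≤)
    to (inj₂ (inj₂ (ℤ.+≤+ 2≤R , p∸1<2E , E≤ , R[p-1-e]≡p-1 , d≡))) =
      inj₂ (inj₂ (2≤R , Equivalence.to (p∸1<2E⇔ E) p∸1<2E , E≤p∸1
                 , ℤP.+-injective (trans (sym (+R*[p-1-E]≡ R E≤p∸1)) (trans R[p-1-e]≡p-1 +p-1≡+[p∸1]))
                 , ℤP.+-injective (trans d≡ (+m-+n≡+[m∸n] 2≤R))))
      where
      E≤p∸1 : E ≤ p ∸ 1
      E≤p∸1 = ℤP.drop‿+≤+ (subst (+ E ℤ.≤_) +p-1≡+[p∸1] E≤)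
    from : InBℕ p R E D → InB p (+ R , + E , + D)
    from (inj₁ (2≤R , R≤p , refl , refl)) = inj₁ (ℤ.+≤+ 2≤R , ℤ.+≤+ R≤p , sym +p-1≡+[p∸1] , refl)
    from (inj₂ (inj₁ (2≤R , R≤p+1 , p∸1<2E , E≤p∸1 , R[p∸1∸E]≤ , refl))) =
      inj₂ (inj₁ (ℤ.+≤+ 2≤R , ℤ.+≤+ R≤p+1 , Equivalence.from (p∸1<2E⇔ E) p∸1<2E
                 , subst (+ E ℤ.≤_) (sym +p-1≡+[p∸1]) (ℤ.+≤+ E≤p∸1)
                 , subst₂ ℤ._≤_ (sym (+R*[p-1-E]≡ R E≤p∸1)) (sym +p-1≡+[p∸1]) (ℤ.+≤+ R[p∸1∸E]≤)
                 , sym (+m-+n≡+[m∸n] (<-trans z<s 2≤R))))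
    from (inj₂ (inj₂ (2≤R , p∸1<2E , E≤p∸1 , R[p∸1∸E]≡p∸1 , refl))) =
      inj₂ (inj₂ (ℤ.+≤+ 2≤R , Equivalence.from (p∸1<2E⇔ E) p∸1<2E
                 , subst (+ E ℤ.≤_) (sym +p-1≡+[p∸1]) (ℤ.+≤+ E≤p∸1)
                 , trans (+R*[p-1-E]≡ R E≤p∸1) (trans (cong +_ R[p∸1∸E]≡p∸1) (sym +p-1≡+[p∸1]))
                 , sym (+m-+n≡+[m∸n] 2≤R)))

  InU-nonneg : ∀ {r e d} → InU p (r , e , d) → ∃₂ λ R E → ∃ λ D → r ≡ + R × e ≡ + E × d ≡ + D
  InU-nonneg (ℤ.+≤+ {n = R} _ , ℤ.+≤+ {n = E} _ , ℤ.+≤+ {n = D} _ , _) = R , E , D , refl , refl , refl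

  +p-1<2e⇒nonneg : ∀ {e} → + p ℤ.- ℤ.1ℤ ℤ.< + 2 ℤ.* e → ∃ λ E → e ≡ + E
  +p-1<2e⇒nonneg {+ E}         _  = E , refl
  +p-1<2e⇒nonneg {ℤ.-[1+ n ]} lt with subst (ℤ._< _) +p-1≡+[p∸1] lt
  ... | ()

  InB-nonneg : ∀ {r e d} → InB p (r , e , d) → ∃₂ λ R E → ∃ λ D → r ≡ + R × e ≡ + E × d ≡ + D
  InB-nonneg (inj₁ (ℤ.+≤+ {n = R} _ , _ , refl , refl)) = R , p ∸ 1 , R , refl , +p-1≡+[p∸1] , refl
  InB-nonneg (inj₂ (inj₁ (ℤ.+≤+ {n = R} 2≤R , _ , p-1<2e , _ , _ , refl))) with +p-1<2e⇒nonneg p-1<2e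
  ... | E , refl = R , E , R ∸ 1 , refl , refl , +m-+n≡+[m∸n] (<-trans z<s 2≤R)
  InB-nonneg (inj₂ (inj₂ (ℤ.+≤+ {n = R} 2≤R , p-1<2e , _ , _ , refl))) with +p-1<2e⇒nonneg p-1<2e
  ... | E , refl = R , E , R ∸ 2 , refl , refl , +m-+n≡+[m∸n] 2≤R

module _ {p : ℕ} (pp : Prime p) where

  private instance
    p≢0 : NonZero p
    p≢0 = prime⇒nonZero pp

  1≤p∸1 : 1 ≤ p ∸ 1
  1≤p∸1 = <⇒≤pred (prime>1 pp)

  p∸1<p : p ∸ 1 < p
  p∸1<p = ≤-reflexive (suc-pred p)

  ≤p∸1⇒<p : ∀ {n} → n ≤ p ∸ 1 → n < p
  ≤p∸1⇒<p n≤p∸1 = ≤-<-trans n≤p∸1 p∸1<p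

  p+1<2p : p + 1 < 2 * p
  p+1<2p = +-monoʳ-< p (subst (1 <_) (sym (+-identityʳ p)) (prime>1 pp))

  prime≢2⇒2∣p∸1 : p ≢ 2 → 2 ∣ p ∸ 1
  prime≢2⇒2∣p∸1 p≢2 with p % 2 | m%n<n p 2 | m≡m%n+[m/n]*n p 2
  ... | 0 | _ | p≡[p/2]*2 with prime⇒irreducible pp (divides (p / 2) p≡[p/2]*2)
  ...   | inj₁ ()
  ...   | inj₂ 2≡p = contradiction (sym 2≡p) p≢2
  prime≢2⇒2∣p∸1 p≢2 | 1 | _ | p≡1+[p/2]*2 = divides (p / 2) (cong (_∸ 1) p≡1+[p/2]*2)
  prime≢2⇒2∣p∸1 p≢2 | suc (suc _) | s≤s (s≤s ()) | _

  prime∤⇒coprime : ∀ {n} → ¬ p ∣ n → Coprime p n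
  prime∤⇒coprime p∤n (d∣p , d∣n) with prime⇒irreducible pp d∣p
  ... | inj₁ d≡1 = d≡1
  ... | inj₂ refl = contradiction d∣n p∤n

  prime∤⇒∤*p : ∀ {R z} → ¬ p ∣ R → 0 < z → z < R → ¬ R ∣ z * p
  prime∤⇒∤*p {R} {z} p∤R 0<z z<R R∣zp = <⇒≱ z<R (∣⇒≤ {{>-nonZero 0<z}} R∣z)
    where
    R∣z : R ∣ z
    R∣z = coprime-divisor (Coprime.sym (prime∤⇒coprime p∤R)) (subst (R ∣_) (*-comm z p) R∣zp)

  -- Solving the equation defining g: g = p - 1 when d = r, and g = 2e - (p - 1) when d = r - 1.
  InB₊ℕ⇒InUℕ : ∀ {R E D} → InB₊ℕ p R E D → InUℕ p R E D
  InB₊ℕ⇒InUℕ {R@(suc R′)} (2≤R , R≤p , refl , refl) = record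
    { 2≤R        = 2≤R
    ; 1≤E        = 1≤p∸1
    ; E≤p∸1      = ≤-refl
    ; 1≤D        = s≤s z≤n
    ; D≤p        = R≤p
    ; D[p∸1]≤RE  = ≤-refl
    ; g          = p ∸ 1
    ; g>0        = 1≤p∸1
    ; g-equation = identity (p ∸ 1) R′
    ; g-even     = prime≢2⇒2∣p∸1
    }
    where
    identity : ∀ q R′ → q * (suc R′ * R′) + suc R′ * (suc R′ + 1) * q ≡ 2 * suc R′ * q * suc R′
    identity = ℕ-Ring.solve-∀

  InB₀ℕ⇒InUℕ : ∀ {R E D} → InB₀ℕ p R E D → InUℕ p R E D
  InB₀ℕ⇒InUℕ {R@(suc R′)} {E} (2≤R , R≤p+1 , p∸1<2E , E≤p∸1 , R[p∸1∸E]≤p∸1 , refl) = record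
    { 2≤R        = 2≤R
    ; 1≤E        = n≢0⇒n>0 λ { refl → n≮0 p∸1<2E }
    ; E≤p∸1      = E≤p∸1
    ; 1≤D        = s≤s⁻¹ 2≤R
    ; D≤p        = s≤s⁻¹ (subst (R ≤_) (+-comm p 1) R≤p+1)
    ; D[p∸1]≤RE  = Equivalence.from (pred[R]P≤RE⇔R[P∸E]≤P R′ E≤p∸1) R[p∸1∸E]≤p∸1
    ; g          = 2 * E ∸ P
    ; g>0        = m<n⇒0<n∸m p∸1<2E
    ; g-equation = g-equation
    ; g-even     = λ p≢2 → ∣m∣n⇒∣m∸n (divides E (*-comm 2 E)) (prime≢2⇒2∣p∸1 p≢2)
    }
    where
    P : ℕ
    P = p ∸ 1
    g-equation : (2 * E ∸ P) * (R * R′) + R′ * (R′ + 1) * P ≡ 2 * R * E * R′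
    g-equation = begin
      (2 * E ∸ P) * (R * R′) + R′ * (R′ + 1) * P  ≡⟨ factor (2 * E ∸ P) P R′ ⟩
      (2 * E ∸ P + P) * (R * R′)                  ≡⟨ cong (_* (R * R′)) (m∸n+n≡m (<⇒≤ p∸1<2E)) ⟩
      2 * E * (R * R′)                            ≡⟨ reorder E R′ ⟩
      2 * R * E * R′                              ∎
      where
      open ≡-Reasoning
      factor : ∀ g P R′ → g * (suc R′ * R′) + R′ * (R′ + 1) * P ≡ (g + P) * (suc R′ * R′)
      factor = ℕ-Ring.solve-∀
      reorder : ∀ E R′ → 2 * E * (suc R′ * R′) ≡ 2 * suc R′ * E * R′
      reorder = ℕ-Ring.solve-∀

  InB₊ℕ⊎InB₀ℕ⇒InUℕ : ∀ {R E D} → InB₊ℕ p R E D ⊎ InB₀ℕ p R E D → InUℕ p R E D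
  InB₊ℕ⊎InB₀ℕ⇒InUℕ (inj₁ b₊) = InB₊ℕ⇒InUℕ b₊
  InB₊ℕ⊎InB₀ℕ⇒InUℕ (inj₂ b₀) = InB₀ℕ⇒InUℕ b₀

  InB₋ℕ⇒R∣p∸1 : ∀ {R E D} → InB₋ℕ p R E D → R ∣ p ∸ 1
  InB₋ℕ⇒R∣p∸1 {R} {E} (_ , _ , _ , R[p∸1∸E]≡p∸1 , _) = divides (p ∸ 1 ∸ E) (trans (sym R[p∸1∸E]≡p∸1) (*-comm R _))

  R∣p∸1⇒R<p : ∀ {R} → R ∣ p ∸ 1 → R < p
  R∣p∸1⇒R<p R∣p∸1 = ≤p∸1⇒<p (∣⇒≤ {{>-nonZero 1≤p∸1}} R∣p∸1)

  R∤p∸1⇒InB₊ℕ⊎InB₀ℕ : ∀ {R E D} → ¬ R ∣ p ∸ 1 → InBℕ p R E D → InB₊ℕ p R E D ⊎ InB₀ℕ p R E D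
  R∤p∸1⇒InB₊ℕ⊎InB₀ℕ R∤p∸1 (inj₁ b₊)        = inj₁ b₊
  R∤p∸1⇒InB₊ℕ⊎InB₀ℕ R∤p∸1 (inj₂ (inj₁ b₀)) = inj₂ b₀
  R∤p∸1⇒InB₊ℕ⊎InB₀ℕ R∤p∸1 (inj₂ (inj₂ b₋)) = contradiction (InB₋ℕ⇒R∣p∸1 b₋) R∤p∸1

  InUℕ⇒D≤R : ∀ {R E D} → InUℕ p R E D → D ≤ R
  InUℕ⇒D≤R {R} {E} {D} u = *-cancelʳ-≤ D R (p ∸ 1) {{>-nonZero 1≤p∸1}} (begin
    D * (p ∸ 1)   ≤⟨ D[p∸1]≤RE ⟩
    R * E         ≤⟨ *-monoʳ-≤ R E≤p∸1 ⟩
    R * (p ∸ 1)   ∎)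
    where
    open InUℕ u
    open ≤-Reasoning

  InUℕ∧D≡R⇒InB₊ℕ : ∀ {R E D} → InUℕ p R E D → D ≡ R → InB₊ℕ p R E D
  InUℕ∧D≡R⇒InB₊ℕ {R} u refl =
    2≤R , D≤p , ≤-antisym E≤p∸1 (*-cancelˡ-≤ R {{>-nonZero (<-trans z<s 2≤R)}} D[p∸1]≤RE) , refl
    where open InUℕ u

  InUℕ∧D≡R∸1⇒InB₀ℕ : ∀ {R E D} → InUℕ p R E D → D ≡ R ∸ 1 → ¬ R ∣ p ∸ 1 → InB₀ℕ p R E D
  InUℕ∧D≡R∸1⇒InB₀ℕ {R@(suc R′)} {E} u refl R∤p∸1 =
    2≤R , subst (R ≤_) (+-comm 1 p) (s≤s D≤p) , p∸1<2E , E≤p∸1 , R[p∸1∸E]≤p∸1 , refl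
    where
    open InUℕ u
    E+x≡p∸1 : E + (p ∸ 1 ∸ E) ≡ p ∸ 1
    E+x≡p∸1 = m+[n∸m]≡n E≤p∸1
    R[p∸1∸E]≤p∸1 : R * (p ∸ 1 ∸ E) ≤ p ∸ 1
    R[p∸1∸E]≤p∸1 = Equivalence.to (pred[R]P≤RE⇔R[P∸E]≤P R′ E≤p∸1) D[p∸1]≤RE
    p∸1<2E : p ∸ 1 < 2 * E
    p∸1<2E = begin-strict
      p ∸ 1                ≡⟨ E+x≡p∸1 ⟨
      E + (p ∸ 1 ∸ E)      <⟨ +-monoʳ-< E (Rx≤E+x⇒x<E 2≤R 1≤E (≤-trans R[p∸1∸E]≤p∸1 (≤-reflexive (sym E+x≡p∸1)))
                                                         (R∤p∸1 ∘ subst (R ∣_) E+x≡p∸1)) ⟩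
      E + E                ≡⟨ cong (_+_ E) (+-identityʳ E) ⟨
      2 * E                ∎
      where open ≤-Reasoning

  1+rowEnd≡ : ∀ i → suc (i * p + (p ∸ 1)) ≡ suc i * p
  1+rowEnd≡ i = trans (sym (+-suc (i * p) (p ∸ 1))) (trans (cong (_+_ (i * p)) (suc-pred p)) (+-comm (i * p) p))

  rowsIncongruent : ∀ {R c i i′} s a a′ → ¬ p ∣ R → i < i′ → i′ < R →
                    i * p + c ≡ s + a * R → ¬ i′ * p + c ≡ s + a′ * R
  rowsIncongruent {R} {c} {i} {i′} s a a′ p∤R i<i′ i′<R rowᵢ≡ rowᵢ′≡ =
    prime∤⇒∤*p p∤R (m<n⇒0<n∸m i<i′) (≤-<-trans (m∸n≤m i′ i) i′<R) (∣m+n∣m⇒∣n (divides a′ aR+zp≡a′R) (n∣m*n a))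
    where
    open ≡-Reasoning
    z : ℕ
    z = i′ ∸ i
    aR+zp≡a′R : a * R + z * p ≡ a′ * R
    aR+zp≡a′R = +-cancelˡ-≡ s _ _ (begin
      s + (a * R + z * p)     ≡⟨ +-assoc s (a * R) (z * p) ⟨
      s + a * R + z * p       ≡⟨ cong (_+ z * p) rowᵢ≡ ⟨
      i * p + c + z * p       ≡⟨ shift-row i z p c ⟩
      (i + z) * p + c         ≡⟨ cong (λ k → k * p + c) (m+[n∸m]≡n (<⇒≤ i<i′)) ⟩
      i′ * p + c              ≡⟨ rowᵢ′≡ ⟩
      s + a′ * R              ∎)
      where
      shift-row : ∀ i z p c → i * p + c + z * p ≡ (i + z) * p + c
      shift-row = ℕ-Ring.solve-∀

  rowResidue-distinct : ∀ {R} .{{_ : NonZero R}} → ¬ p ∣ R → ∀ {i i′} → i < i′ → i′ < R →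
                        (i * p + (p ∸ 1)) % R ≢ (i′ * p + (p ∸ 1)) % R
  rowResidue-distinct {R} p∤R {i} {i′} i<i′ i′<R sᵢ≡sᵢ′ =
    rowsIncongruent (N i % R) (N i / R) (N i′ / R) p∤R i<i′ i′<R (m≡m%n+[m/n]*n (N i) R)
      (trans (m≡m%n+[m/n]*n (N i′) R) (cong (_+ N i′ / R * R) (sym sᵢ≡sᵢ′)))
    where
    N : ℕ → ℕ
    N k = k * p + (p ∸ 1)

  rowResidue<D : ∀ {R D i} .{{_ : NonZero R}} → ¬ p ∣ R → R ≤ suc D → i < D → (i * p + (p ∸ 1)) % R < D
  rowResidue<D {R} {D} {i} p∤R R≤1+D i<D with (i * p + (p ∸ 1)) % R <? D
  ... | yes s<D = s<D
  ... | no  s≮D = contradiction R∣[1+i]p (prime∤⇒∤*p p∤R z<s (<-≤-trans (s≤s i<D) (≤-reflexive (sym R≡1+D))))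
    where
    open ≡-Reasoning
    N : ℕ
    N = i * p + (p ∸ 1)
    s : ℕ
    s = N % R
    R≡1+D : R ≡ suc D
    R≡1+D = ≤-antisym R≤1+D (≤-trans (s≤s (≮⇒≥ s≮D)) (m%n<n N R))
    s≡D : s ≡ D
    s≡D = ≤-antisym (s≤s⁻¹ (≤-trans (m%n<n N R) R≤1+D)) (≮⇒≥ s≮D)
    R∣[1+i]p : R ∣ suc i * p
    R∣[1+i]p = divides (suc (N / R)) (begin
      suc i * p           ≡⟨ 1+rowEnd≡ i ⟨
      suc N               ≡⟨ cong suc (m≡m%n+[m/n]*n N R) ⟩
      suc s + N / R * R   ≡⟨ cong (λ m → suc m + N / R * R) s≡D ⟩
      suc D + N / R * R   ≡⟨ cong (_+ N / R * R) R≡1+D ⟨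
      suc (N / R) * R     ∎)

  rowMultiple : ∀ {R E D} → ¬ p ∣ R → D ≤ R → R ≤ suc D → D ≤ p → D * (p ∸ 1) ≤ R * E → ∀ {i} → i < D →
                ∃₂ λ j a → j < D × a ≤ E × i * p + (p ∸ D) + j ≡ a * R
  rowMultiple {R} {E} {D} p∤R D≤R R≤1+D D≤p DP≤RE {i} i<D = pred D ∸ s , N / R , j<D , a≤E , row≡aR
    where
    instance
      R≢0 : NonZero R
      R≢0 = >-nonZero (<-≤-trans (≤-<-trans z≤n i<D) D≤R)
    N : ℕ
    N = i * p + (p ∸ 1)
    s : ℕ
    s = N % R
    s≤pred[D] : s ≤ pred D
    s≤pred[D] = <⇒≤pred (rowResidue<D p∤R R≤1+D i<D)
    j<D : pred D ∸ s < D
    j<D = ≤-<-trans (m∸n≤m (pred D) s) (≤-reflexive (suc-pred D {{>-nonZero (≤-<-trans z≤n i<D)}}))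
    row≡aR : i * p + (p ∸ D) + (pred D ∸ s) ≡ N / R * R
    row≡aR = +-cancelʳ-≡ s _ _ (begin
      i * p + (p ∸ D) + (pred D ∸ s) + s                     ≡⟨ cong (λ k → i * p + (p ∸ D) + (pred D ∸ s) + k) (m∸[m∸n]≡n s≤pred[D]) ⟨
      i * p + (p ∸ D) + (pred D ∸ s) + (pred D ∸ (pred D ∸ s)) ≡⟨ Mat-index-rowEnd i D≤p j<D ⟩
      N                                                      ≡⟨ m≡m%n+[m/n]*n N R ⟩
      s + N / R * R                                          ≡⟨ +-comm s (N / R * R) ⟩
      N / R * R + s                                          ∎)
      where open ≡-Reasoning
    a≤E : N / R ≤ E
    a≤E = s≤s⁻¹ (*-cancelʳ-< R (N / R) (suc E) (begin-strict
      N / R * R          ≤⟨ m≤n+m (N / R * R) s ⟩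
      s + N / R * R      ≡⟨ m≡m%n+[m/n]*n N R ⟨
      N                  <⟨ ≤-reflexive (1+rowEnd≡ i) ⟩
      suc i * p          ≤⟨ *-monoˡ-≤ p i<D ⟩
      D * p              ≡⟨ cong (D *_) (suc-pred p) ⟨
      D * suc (p ∸ 1)    ≡⟨ *-suc D (p ∸ 1) ⟩
      D + D * (p ∸ 1)    ≤⟨ +-mono-≤ D≤R DP≤RE ⟩
      R + R * E          ≡⟨ *-suc R E ⟨
      R * suc E          ≡⟨ *-comm R (suc E) ⟩
      suc E * R          ∎))
      where open ≤-Reasoning

  binomial-detNonzero : ∀ {R E D} → ¬ p ∣ R → E < p → D ≤ R → R ≤ suc D → D ≤ p → D * (p ∸ 1) ≤ R * E →
                        detNonzero p (binomial R) E D
  binomial-detNonzero {R} {E} {D} p∤R E<p D≤R R≤1+D D≤p DP≤RE =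
    prime∤det-monomial pp D M σ σ-injective off≡0 p∤diag
    where
    M : Matrix D
    M = Mat p (binomial R) E D
    window : Fin D → ℕ
    window i = toℕ i * p + (p ∸ D)
    row : ∀ i → ∃₂ λ j a → j < D × a ≤ E × window i + j ≡ a * R
    row i = rowMultiple p∤R D≤R R≤1+D D≤p DP≤RE (Fin.toℕ<n i)
    σ : Fin D → Fin D
    σ i = fromℕ< (proj₁ (proj₂ (proj₂ (row i))))
    mult : Fin D → ℕ
    mult i = proj₁ (proj₂ (row i))
    mult≤E : ∀ i → mult i ≤ E
    mult≤E i = proj₁ (proj₂ (proj₂ (proj₂ (row i))))
    σ-multiple : ∀ i → window i + toℕ (σ i) ≡ mult i * R
    σ-multiple i = trans (cong (_+_ (window i)) (Fin.toℕ-fromℕ< _)) (proj₂ (proj₂ (proj₂ (proj₂ (row i)))))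
    <R : ∀ (j : Fin D) → toℕ j < R
    <R j = <-≤-trans (Fin.toℕ<n j) D≤R
    off≡0 : ∀ i k → k ≢ σ i → M i k ≡ ℤ.0ℤ
    off≡0 i k k≢σᵢ = trans (Mat-entry p (binomial R) E D i k D≤p) (≢0-by-contradiction onlyMultiple)
      where
      onlyMultiple : ¬ coeff (binomial R ^ᴾ E) (window i + toℕ k) ≢ ℤ.0ℤ
      onlyMultiple c≢0 with binomial^-support R E _ c≢0
      ... | b , _ , window+k≡bR = k≢σᵢ (Fin.toℕ-injective
              (multiplesInWindow-unique b (mult i) (<R k) (<R (σ i)) window+k≡bR (σ-multiple i)))
    p∤diag : ∀ i → ¬ p ∣ ∣ M i (σ i) ∣
    p∤diag i = subst (λ x → ¬ p ∣ ∣ x ∣)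
      (sym (trans (Mat-entry p (binomial R) E D i (σ i) D≤p)
                  (trans (cong (coeff (binomial R ^ᴾ E)) (σ-multiple i))
                         (coeff-binomial^ R {{>-nonZero (≤-<-trans z≤n (<R (σ i)))}} E (mult i)))))
      (prime∤signedChoose pp E<p (mult≤E i))
    row≡ : ∀ i → toℕ i * p + (p ∸ D + toℕ (σ i)) ≡ 0 + mult i * R
    row≡ i = trans (sym (+-assoc (toℕ i * p) (p ∸ D) (toℕ (σ i)))) (σ-multiple i)
    σ-inj< : ∀ {i i′} → toℕ i < toℕ i′ → σ i ≢ σ i′
    σ-inj< {i} {i′} i<i′ σᵢ≡σᵢ′ = rowsIncongruent 0 (mult i) (mult i′) p∤R i<i′ (<R i′) (row≡ i)
      (subst (λ k → toℕ i′ * p + (p ∸ D + toℕ k) ≡ 0 + mult i′ * R) (sym σᵢ≡σᵢ′) (row≡ i′))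
    σ-injective : Injective _≡_ _≡_ σ
    σ-injective {i} {i′} σᵢ≡σᵢ′ with <-cmp (toℕ i) (toℕ i′)
    ... | tri< i<i′ _ _ = contradiction σᵢ≡σᵢ′ (σ-inj< i<i′)
    ... | tri≈ _ i≡i′ _ = Fin.toℕ-injective i≡i′
    ... | tri> _ _ i′<i = contradiction (sym σᵢ≡σᵢ′) (σ-inj< i′<i)

  InB₊ℕ⊎InB₀ℕ⇒binomial-detNonzero : ∀ {R E D} → ¬ p ∣ R → InB₊ℕ p R E D ⊎ InB₀ℕ p R E D →
                                     detNonzero p (binomial R) E D
  InB₊ℕ⊎InB₀ℕ⇒binomial-detNonzero p∤R b₊⊎b₀ =
    binomial-detNonzero p∤R (≤p∸1⇒<p E≤p∸1) (proj₁ (InB₊ℕ⊎InB₀ℕ⇒D≤R≤1+D b₊⊎b₀)) (proj₂ (InB₊ℕ⊎InB₀ℕ⇒D≤R≤1+D b₊⊎b₀))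
                        D≤p D[p∸1]≤RE
    where open InUℕ (InB₊ℕ⊎InB₀ℕ⇒InUℕ b₊⊎b₀)

  -- Part (i)

  trinomial-detNonzero : ∀ {D} → D ≤ p → detNonzero p (trinomial p) (p ∸ 1) D
  trinomial-detNonzero {D} D≤p = prime∤det-antiTriangular pp D M below≡0 p∤antiDiagonal
    where
    M : Matrix D
    M = Mat p (trinomial p) (p ∸ 1) D
    K : ℕ
    K = p ∸ D
    c : ℕ → ℤ
    c = coeff (trinomial p ^ᴾ (p ∸ 1))
    entry : ∀ i j → M i j ≡ c (toℕ i * p + (K + toℕ j))
    entry i j = trans (Mat-entry p (trinomial p) (p ∸ 1) D i j D≤p) (cong c (+-assoc (toℕ i * p) K (toℕ j)))
    swap : ∀ K i j → K + (i + j) ≡ i + (K + j)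
    swap = ℕ-Ring.solve-∀
    below≡0 : ∀ i j → D ≤ toℕ i + toℕ j → M i j ≡ ℤ.0ℤ
    below≡0 i j D≤i+j = trans (entry i j)
      (coeff-trinomial^≡0 (toℕ i) (K + toℕ j) p∸1<p (p∸d+j<p D≤p (Fin.toℕ<n j)) (<-≤-trans p∸1<p p≤i+K+j))
      where
      p≤i+K+j : p ≤ toℕ i + (K + toℕ j)
      p≤i+K+j = begin
        p                        ≡⟨ m∸n+n≡m D≤p ⟨
        K + D                    ≤⟨ +-monoʳ-≤ K D≤i+j ⟩
        K + (toℕ i + toℕ j)      ≡⟨ swap K (toℕ i) (toℕ j) ⟩
        toℕ i + (K + toℕ j)      ∎
        where open ≤-Reasoning
    p∤antiDiagonal : ∀ i j → suc (toℕ i + toℕ j) ≡ D → ¬ p ∣ ∣ M i j ∣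
    p∤antiDiagonal i j 1+i+j≡D =
      subst (λ x → ¬ p ∣ ∣ x ∣) (sym M≡) (prime∤signedChoose pp p∸1<p (subst (toℕ i ≤_) i+K+j≡p∸1 (m≤m+n (toℕ i) _)))
      where
      open ≡-Reasoning
      i+K+j≡p∸1 : toℕ i + (K + toℕ j) ≡ p ∸ 1
      i+K+j≡p∸1 = cong pred (begin
        suc (toℕ i + (K + toℕ j))  ≡⟨ cong suc (swap K (toℕ i) (toℕ j)) ⟨
        suc (K + (toℕ i + toℕ j))  ≡⟨ +-suc K (toℕ i + toℕ j) ⟨
        K + suc (toℕ i + toℕ j)    ≡⟨ cong (_+_ K) 1+i+j≡D ⟩
        K + D                      ≡⟨ m∸n+n≡m D≤p ⟩
        p                          ∎)
      M≡ : M i j ≡ signedChoose (p ∸ 1) (toℕ i)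
      M≡ = begin
        M i j                                 ≡⟨ entry i j ⟩
        c (toℕ i * p + (K + toℕ j))           ≡⟨ cong (λ m → c (toℕ i * p + m)) (m+n∸m≡n (toℕ i) (K + toℕ j)) ⟨
        c (toℕ i * p + (toℕ i + (K + toℕ j) ∸ toℕ i)) ≡⟨ cong (λ m → c (toℕ i * p + (m ∸ toℕ i))) i+K+j≡p∸1 ⟩
        c (toℕ i * p + (p ∸ 1 ∸ toℕ i))       ≡⟨ coeff-trinomial^ p (p ∸ 1) p∸1<p (toℕ i) ⟩
        signedChoose (p ∸ 1) (toℕ i)          ∎

  trinomialᵖ-detNonzero⇒E≡p∸1 : ∀ {E D} → E < p → 1 ≤ D → D ≤ p → detNonzero p (trinomial p) E D → E ≡ p ∸ 1
  trinomialᵖ-detNonzero⇒E≡p∸1 {E} {D@(suc D′)} E<p _ D≤p det≢0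
    with detNonzero-trinomial⇒row D≤p det≢0 (n<1+n D′)
  ... | j , a , m , j<D , a+m≤E , lastRow≡
    with quotRem-unique D′ a (p∸d+j<p D≤p j<D) (≤-<-trans (≤-trans (m≤n+m m a) a+m≤E) E<p)
                        (trans (sym (+-assoc (D′ * p) (p ∸ D) j)) lastRow≡)
  ... | refl , refl = ≤-antisym (<⇒≤pred E<p) (begin
    p ∸ 1                  ≡⟨ cong pred (m+[n∸m]≡n D≤p) ⟨
    D′ + (p ∸ D)           ≤⟨ +-monoʳ-≤ D′ (m≤m+n (p ∸ D) j) ⟩
    D′ + (p ∸ D + j)       ≤⟨ a+m≤E ⟩
    E                      ∎)
    where open ≤-Reasoning

  g-equationᵖ⇒D≡p⊎D≡p∸1 : ∀ {g D} → 1 ≤ D → D ≤ p →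
                           g * (p * (p ∸ 1)) + D * (D + 1) * (p ∸ 1) ≡ 2 * p * (p ∸ 1) * D → D ≡ p ⊎ D ≡ p ∸ 1
  g-equationᵖ⇒D≡p⊎D≡p∸1 {g} {D} 1≤D D≤p g-eq with euclidsLemma D (D + 1) pp p∣D[D+1]
    where
    P : ℕ
    P = p ∸ 1
    gp+D[D+1]≡2Dp : g * p + D * (D + 1) ≡ 2 * D * p
    gp+D[D+1]≡2Dp = *-cancelʳ-≡ _ _ P {{>-nonZero 1≤p∸1}} (begin
      (g * p + D * (D + 1)) * P              ≡⟨ factor g p P D ⟨
      g * (p * P) + D * (D + 1) * P          ≡⟨ g-eq ⟩
      2 * p * P * D                          ≡⟨ reorder p P D ⟩
      2 * D * p * P                          ∎)
      where
      open ≡-Reasoning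
      factor : ∀ g p P D → g * (p * P) + D * (D + 1) * P ≡ (g * p + D * (D + 1)) * P
      factor = ℕ-Ring.solve-∀
      reorder : ∀ p P D → 2 * p * P * D ≡ 2 * D * p * P
      reorder = ℕ-Ring.solve-∀
    p∣D[D+1] : p ∣ D * (D + 1)
    p∣D[D+1] = ∣m+n∣m⇒∣n (divides (2 * D) gp+D[D+1]≡2Dp) (n∣m*n g)
  ... | inj₁ p∣D   = inj₁ (≤-antisym D≤p (∣⇒≤ {{>-nonZero 1≤D}} p∣D))
  ... | inj₂ p∣D+1 = inj₂ (cong pred (trans (+-comm 1 D) D+1≡p))
    where
    D+1≡p : D + 1 ≡ p
    D+1≡p = m∣n∧0<n<2m⇒n≡m p∣D+1 (subst (0 <_) (+-comm 1 D) z<s)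
              (≤-<-trans (+-monoˡ-≤ 1 D≤p) p+1<2p)

  2p≤R∧2≤D⇒¬trinomial-detNonzero : ∀ {R E D} → 2 * p ≤ R → E < p → 2 ≤ D → D ≤ p → ¬ detNonzero p (trinomial R) E D
  2p≤R∧2≤D⇒¬trinomial-detNonzero {R} {E} {D} 2p≤R E<p 2≤D D≤p det≢0 with detNonzero-trinomial⇒row D≤p det≢0 2≤D
  ... | j , zero    , m , j<D , m≤E , row≡ = <⇒≱ E<p (≤-trans p≤row (≤-trans (≤-reflexive row≡) m≤E))
    where
    p≤row : p ≤ 1 * p + (p ∸ D) + j
    p≤row = ≤-trans (≤-reflexive (sym (*-identityˡ p))) (≤-trans (m≤m+n (1 * p) (p ∸ D)) (m≤m+n _ j))
  ... | j , suc a , m , j<D , _   , row≡ = <⇒≱ row<2p (≤-trans 2p≤R R≤row)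
    where
    open ≤-Reasoning
    R≤row : R ≤ 1 * p + (p ∸ D) + j
    R≤row = begin
      R                       ≤⟨ m≤m+n R (a * R + m) ⟩
      R + (a * R + m)         ≡⟨ +-assoc R (a * R) m ⟨
      suc a * R + m           ≡⟨ row≡ ⟨
      1 * p + (p ∸ D) + j     ∎
    row<2p : 1 * p + (p ∸ D) + j < 2 * p
    row<2p = begin-strict
      1 * p + (p ∸ D) + j     ≡⟨ +-assoc (1 * p) (p ∸ D) j ⟩
      1 * p + (p ∸ D + j)     <⟨ +-monoʳ-< (1 * p) (p∸d+j<p D≤p j<D) ⟩
      1 * p + p               ≡⟨ double p ⟩
      2 * p                   ∎
      where
      double : ∀ p → 1 * p + p ≡ 2 * p
      double = ℕ-Ring.solve-∀

  g-equation[D≡1]⇒gR≡2[p∸1] : ∀ {R g} → 2 ≤ R → g * (R * (R ∸ 1)) + 1 * (1 + 1) * (p ∸ 1) ≡ 2 * R * (p ∸ 1) * 1 →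
                   g * R ≡ 2 * (p ∸ 1)
  g-equation[D≡1]⇒gR≡2[p∸1] {zero} () _
  g-equation[D≡1]⇒gR≡2[p∸1] {R@(suc R′)} {g} 2≤R g-eq =
    *-cancelʳ-≡ (g * R) (2 * P) R′ {{>-nonZero (s≤s⁻¹ 2≤R)}} (+-cancelʳ-≡ (2 * P) _ _ (begin
      g * R * R′ + 2 * P                 ≡⟨ lhs g R′ P ⟩
      g * (R * R′) + 1 * (1 + 1) * P     ≡⟨ g-eq ⟩
      2 * R * P * 1                      ≡⟨ rhs R′ P ⟩
      2 * P * R′ + 2 * P                 ∎))
    where
    open ≡-Reasoning
    P : ℕ
    P = p ∸ 1
    lhs : ∀ g R′ P → g * suc R′ * R′ + 2 * P ≡ g * (suc R′ * R′) + 1 * (1 + 1) * P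
    lhs = ℕ-Ring.solve-∀
    rhs : ∀ R′ P → 2 * suc R′ * P * 1 ≡ 2 * P * R′ + 2 * P
    rhs = ℕ-Ring.solve-∀

  trinomial-D≡1⇒R<2p : ∀ {R E} → InUℕ p R E 1 → detNonzero p (trinomial R) E 1 → R < 2 * p
  trinomial-D≡1⇒R<2p {R} {E} u det≢0 with detNonzero-trinomial⇒row (InUℕ.D≤p u) det≢0 z<s
  ... | j , suc a , m , j<1 , _ , row≡ =
    <-≤-trans (≤-<-trans R≤row (p∸d+j<p (InUℕ.D≤p u) j<1)) (m≤m+n p (p + 0))
    where
    R≤row : R ≤ p ∸ 1 + j
    R≤row = ≤-trans (m≤m+n R (a * R + m)) (≤-reflexive (trans (sym (+-assoc R (a * R) m)) (sym row≡)))
  ... | j , zero , m , j<1 , m≤E , row≡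
    with ≤-antisym (InUℕ.E≤p∸1 u) (≤-trans (m≤m+n (p ∸ 1) j) (≤-trans (≤-reflexive row≡) m≤E))
  ...   | refl = begin-strict
    R              ≤⟨ m≤n*m R g {{>-nonZero g>0}} ⟩
    g * R          ≡⟨ g-equation[D≡1]⇒gR≡2[p∸1] {g = g} 2≤R g-equation ⟩
    2 * (p ∸ 1)    <⟨ *-monoʳ-< 2 p∸1<p ⟩
    2 * p          ∎
    where
    open InUℕ u
    open ≤-Reasoning

  trinomial-detNonzero⇒R<2p : ∀ {R E D} → InUℕ p R E D → detNonzero p (trinomial R) E D → R < 2 * p
  trinomial-detNonzero⇒R<2p {D = zero}          u _      = contradiction (InUℕ.1≤D u) λ ()
  trinomial-detNonzero⇒R<2p {D = suc zero}      u det≢0 = trinomial-D≡1⇒R<2p u det≢0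
  trinomial-detNonzero⇒R<2p {D = suc (suc _)}   u det≢0 = ≰⇒> λ 2p≤R →
    2p≤R∧2≤D⇒¬trinomial-detNonzero 2p≤R (≤p∸1⇒<p E≤p∸1) (s≤s (s≤s z≤n)) D≤p det≢0
    where open InUℕ u

  p∣R∧trinomial-detNonzero⇒R≡p×E≡p∸1 : ∀ {R E D} → InUℕ p R E D → p ∣ R → detNonzero p (trinomial R) E D →
                                     R ≡ p × E ≡ p ∸ 1 × (D ≡ p ⊎ D ≡ p ∸ 1)
  p∣R∧trinomial-detNonzero⇒R≡p×E≡p∸1 u p∣R det≢0
    with m∣n∧0<n<2m⇒n≡m p∣R (<-trans z<s (InUℕ.2≤R u)) (trinomial-detNonzero⇒R<2p u det≢0)
  ... | refl with trinomialᵖ-detNonzero⇒E≡p∸1 (≤p∸1⇒<p (InUℕ.E≤p∸1 u)) (InUℕ.1≤D u) (InUℕ.D≤p u) det≢0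
  ...   | refl = refl , refl , g-equationᵖ⇒D≡p⊎D≡p∸1 {g = g} 1≤D D≤p g-equation
    where open InUℕ u

  p∣R∧InB₊ℕ⊎InB₀ℕ⇒R≡p×E≡p∸1 : ∀ {R E D} → p ∣ R → InB₊ℕ p R E D ⊎ InB₀ℕ p R E D → R ≡ p × E ≡ p ∸ 1
  p∣R∧InB₊ℕ⊎InB₀ℕ⇒R≡p×E≡p∸1 p∣R (inj₁ (2≤R , R≤p , E≡p∸1 , _)) =
    m∣n∧0<n<2m⇒n≡m p∣R (<-trans z<s 2≤R) (≤-<-trans (≤-trans R≤p (m≤m+n p 1)) p+1<2p) , E≡p∸1
  p∣R∧InB₊ℕ⊎InB₀ℕ⇒R≡p×E≡p∸1 {E = E} p∣R (inj₂ (2≤R , R≤p+1 , _ , E≤p∸1 , R[p∸1∸E]≤p∸1 , _))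
    with m∣n∧0<n<2m⇒n≡m p∣R (<-trans z<s 2≤R) (≤-<-trans R≤p+1 p+1<2p)
  ... | refl = refl , ≤-antisym E≤p∸1 (m∸n≡0⇒m≤n p∸1∸E≡0)
    where
    p∸1∸E≡0 : p ∸ 1 ∸ E ≡ 0
    p∸1∸E≡0 = n≤0⇒n≡0 (≮⇒≥ λ 0<x → <⇒≱ p∸1<p (≤-trans (m≤m*n p (p ∸ 1 ∸ E) {{>-nonZero 0<x}}) R[p∸1∸E]≤p∸1))

  D≡p⊎D≡p∸1⇒InBℕ : ∀ {D} → D ≡ p ⊎ D ≡ p ∸ 1 → InBℕ p p (p ∸ 1) D
  D≡p⊎D≡p∸1⇒InBℕ (inj₁ refl) = inj₁ (prime>1 pp , ≤-refl , refl , refl)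
  D≡p⊎D≡p∸1⇒InBℕ (inj₂ refl) = inj₂ (inj₁ (prime>1 pp , m≤m+n p 1 , p∸1<2[p∸1] , ≤-refl , p*0≤p∸1 , refl))
    where
    p∸1<2[p∸1] : p ∸ 1 < 2 * (p ∸ 1)
    p∸1<2[p∸1] = m<m+n (p ∸ 1) (≤-trans 1≤p∸1 (m≤m+n (p ∸ 1) 0))
    p*0≤p∸1 : p * (p ∸ 1 ∸ (p ∸ 1)) ≤ p ∸ 1
    p*0≤p∸1 = ≤-trans (≤-reflexive (trans (cong (p *_) (n∸n≡0 (p ∸ 1))) (*-zeroʳ p))) z≤n

  partI : ∀ r e d → (InU p (r , e , d) × (+ p) ℤD.∣ r × detNZ p trinomial (r , e , d))
                  ⇔ (InB p (r , e , d) × (+ p) ℤD.∣ r)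
  partI r e d = mk⇔ to from
    where
    to : InU p (r , e , d) × (+ p) ℤD.∣ r × detNZ p trinomial (r , e , d) → InB p (r , e , d) × (+ p) ℤD.∣ r
    to (u , p∣R , det≢0) with InU-nonneg u
    ... | R , E , D , refl , refl , refl with p∣R∧trinomial-detNonzero⇒R≡p×E≡p∸1 (Equivalence.to (InU⇔InUℕ R E D) u) p∣R det≢0
    ...   | refl , refl , D≡p⊎D≡p∸1 = Equivalence.from (InB⇔InBℕ p (p ∸ 1) D) (D≡p⊎D≡p∸1⇒InBℕ D≡p⊎D≡p∸1) , p∣R
    from : InB p (r , e , d) × (+ p) ℤD.∣ r → InU p (r , e , d) × (+ p) ℤD.∣ r × detNZ p trinomial (r , e , d)
    from (b , p∣R) with InB-nonneg b
    ... | R , E , D , refl , refl , refl with R∤p∸1⇒InB₊ℕ⊎InB₀ℕ R∤p∸1 (Equivalence.to (InB⇔InBℕ R E D) b)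
      where
      R∤p∸1 : ¬ R ∣ p ∸ 1
      R∤p∸1 R∣p∸1 = <-irrefl refl (R∣p∸1⇒R<p (∣-trans p∣R R∣p∸1))
    ...   | b₊⊎b₀ with p∣R∧InB₊ℕ⊎InB₀ℕ⇒R≡p×E≡p∸1 p∣R b₊⊎b₀
    ...     | refl , refl = Equivalence.from (InU⇔InUℕ p (p ∸ 1) D) u , p∣R , trinomial-detNonzero (InUℕ.D≤p u)
      where
      u : InUℕ p p (p ∸ 1) D
      u = InB₊ℕ⊎InB₀ℕ⇒InUℕ b₊⊎b₀

  -- Part (ii)

  binomial-p<R⇒D≡p : ∀ {R E D} → p < R → 1 ≤ D → D ≤ p → detNonzero p (binomial R) E D → D ≡ p
  binomial-p<R⇒D≡p {R} {E} {D} p<R 1≤D D≤p det≢0 with detNonzero-binomial⇒row {e = E} D≤p det≢0 1≤D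
  ... | j , zero    , _   , _ , row≡ = ≤-antisym D≤p (m∸n≡0⇒m≤n (m+n≡0⇒m≡0 (p ∸ D) row≡))
  ... | j , suc a , j<D , _ , row≡ = contradiction (<-trans (p∸d+j<p D≤p j<D) p<R) (≤⇒≯ R≤row)
    where
    R≤row : R ≤ p ∸ D + j
    R≤row = ≤-trans (m≤m+n R (a * R)) (≤-reflexive (sym row≡))

  binomial-rowMultipleᵖ : ∀ {R E} → detNonzero p (binomial R) E p → ∀ {i} → i < p →
                          ∃ λ a → i * p ≤ a * R × a * R ≤ i * p + (p ∸ 1)
  binomial-rowMultipleᵖ {R} {E} det≢0 {i} i<p with detNonzero-binomial⇒row {e = E} ≤-refl det≢0 i<p
  ... | j , a , j<p , _ , row≡ =
    a , ≤-trans (m≤m+n (i * p) j) (≤-reflexive ip+j≡aR) , ≤-trans (≤-reflexive (sym ip+j≡aR)) (+-monoʳ-≤ (i * p) (<⇒≤pred j<p))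
    where
    ip+j≡aR : i * p + j ≡ a * R
    ip+j≡aR = trans (cong (_+ j) (sym (+-identityʳ (i * p)))) (trans (cong (λ k → i * p + k + j) (sym (n∸n≡0 p))) row≡)

  -- the multiples of R found in consecutive rows increase strictly
  binomial-rowMultipleᵖ≥row : ∀ {R E} → detNonzero p (binomial R) E p → ∀ i → i < p →
                              ∃ λ a → i ≤ a × a * R ≤ i * p + (p ∸ 1)
  binomial-rowMultipleᵖ≥row {E = E} det≢0 zero 0<p with binomial-rowMultipleᵖ {E = E} det≢0 0<p
  ... | a , _ , aR≤ = a , z≤n , aR≤
  binomial-rowMultipleᵖ≥row {R} {E} det≢0 (suc i) 1+i<p
    with binomial-rowMultipleᵖ≥row {E = E} det≢0 i (<-trans (n<1+n i) 1+i<p) | binomial-rowMultipleᵖ {E = E} det≢0 1+i<p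
  ... | a′ , i≤a′ , a′R≤ | a , [1+i]p≤aR , aR≤ = a , ≤-trans (s≤s i≤a′) a′<a , aR≤
    where
    a′<a : a′ < a
    a′<a = *-cancelʳ-< R a′ a (begin-strict
      a′ * R           ≤⟨ a′R≤ ⟩
      i * p + (p ∸ 1)  <⟨ +-monoʳ-< (i * p) p∸1<p ⟩
      i * p + p        ≡⟨ +-comm (i * p) p ⟩
      suc i * p        ≤⟨ [1+i]p≤aR ⟩
      a * R            ∎)
      where open ≤-Reasoning

  binomial-p<R⇒R≡1+p×D≡p : ∀ {R E D} → p < R → 1 ≤ D → D ≤ p → detNonzero p (binomial R) E D → R ≡ suc p × D ≡ p
  binomial-p<R⇒R≡1+p×D≡p {R} {E} p<R 1≤D D≤p det≢0 with binomial-p<R⇒D≡p {E = E} p<R 1≤D D≤p det≢0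
  ... | refl with binomial-rowMultipleᵖ≥row {E = E} det≢0 (p ∸ 1) p∸1<p
  ...   | a , p∸1≤a , aR≤ = ≤-antisym R≤1+p p<R , refl
    where
    R≤1+p : R ≤ suc p
    R≤1+p = *-cancelˡ-≤ (p ∸ 1) {{>-nonZero 1≤p∸1}} (begin
      (p ∸ 1) * R              ≤⟨ *-monoˡ-≤ R p∸1≤a ⟩
      a * R                    ≤⟨ aR≤ ⟩
      (p ∸ 1) * p + (p ∸ 1)    ≡⟨ +-comm ((p ∸ 1) * p) (p ∸ 1) ⟩
      p ∸ 1 + (p ∸ 1) * p      ≡⟨ *-suc (p ∸ 1) p ⟨
      (p ∸ 1) * suc p          ∎)
      where open ≤-Reasoning

  partII : ∀ r e d → (InU p (r , e , d) × + p ℤ.< r × ¬ ((+ p) ℤD.∣ r) × detNZ p binomial (r , e , d))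
                   ⇔ (InB p (r , e , d) × + p ℤ.< r × ¬ ((+ p) ℤD.∣ r))
  partII r e d = mk⇔ to from
    where
    to : InU p (r , e , d) × + p ℤ.< r × ¬ ((+ p) ℤD.∣ r) × detNZ p binomial (r , e , d) →
         InB p (r , e , d) × + p ℤ.< r × ¬ ((+ p) ℤD.∣ r)
    to (u , p<R , p∤R , det≢0) with InU-nonneg u
    ... | R , E , D , refl , refl , refl
      with binomial-p<R⇒R≡1+p×D≡p {E = E} (ℤP.drop‿+<+ p<R) (InUℕ.1≤D uℕ) (InUℕ.D≤p uℕ) det≢0
      where uℕ = Equivalence.to (InU⇔InUℕ R E D) u
    ...   | refl , refl = Equivalence.from (InB⇔InBℕ (suc p) E p) (inj₂ (inj₁ (InUℕ∧D≡R∸1⇒InB₀ℕ uℕ refl 1+p∤p∸1)))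
                        , p<R , p∤R
      where
      uℕ : InUℕ p (suc p) E p
      uℕ = Equivalence.to (InU⇔InUℕ (suc p) E p) u
      1+p∤p∸1 : ¬ suc p ∣ p ∸ 1
      1+p∤p∸1 1+p∣p∸1 = <-asym (R∣p∸1⇒R<p 1+p∣p∸1) (n<1+n p)
    from : InB p (r , e , d) × + p ℤ.< r × ¬ ((+ p) ℤD.∣ r) →
           InU p (r , e , d) × + p ℤ.< r × ¬ ((+ p) ℤD.∣ r) × detNZ p binomial (r , e , d)
    from (b , p<R , p∤R) with InB-nonneg b
    ... | R , E , D , refl , refl , refl =
      Equivalence.from (InU⇔InUℕ R E D) (InB₊ℕ⊎InB₀ℕ⇒InUℕ b₊⊎b₀) , p<R , p∤R , InB₊ℕ⊎InB₀ℕ⇒binomial-detNonzero p∤R b₊⊎b₀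
      where
      b₊⊎b₀ : InB₊ℕ p R E D ⊎ InB₀ℕ p R E D
      b₊⊎b₀ = R∤p∸1⇒InB₊ℕ⊎InB₀ℕ (λ R∣p∸1 → <-asym (R∣p∸1⇒R<p R∣p∸1) (ℤP.drop‿+<+ p<R)) (Equivalence.to (InB⇔InBℕ R E D) b)

  -- Part (iii)

  2≤p%R : ∀ {R} .{{_ : NonZero R}} → 2 ≤ R → R < p → ¬ R ∣ p ∸ 1 → 2 ≤ p % R
  2≤p%R {R} 2≤R R<p R∤p∸1 with p % R in p%R≡
  ... | 0 with prime⇒irreducible pp (m%n≡0⇒n∣m p R p%R≡)
  ...   | inj₁ R≡1 = contradiction (sym R≡1) (<⇒≢ 2≤R)
  ...   | inj₂ R≡p = contradiction R≡p (<⇒≢ R<p)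
  2≤p%R {R} 2≤R R<p R∤p∸1 | 1 =
    contradiction (divides (p / R) (cong pred (trans (m≡m%n+[m/n]*n p R) (cong (_+ p / R * R) p%R≡)))) R∤p∸1
  2≤p%R {R} 2≤R R<p R∤p∸1 | suc (suc _) = s≤s (s≤s z≤n)

  binomial-R<p⇒R∸1≤D : ∀ {R E D} → 2 ≤ R → R < p → ¬ R ∣ p ∸ 1 → 1 ≤ D → D < R →
                       detNonzero p (binomial R) E D → pred R ≤ D
  binomial-R<p⇒R∸1≤D {R} {E} {D} 2≤R R<p R∤p∸1 1≤D D<R det≢0 = ≮⇒≥ λ D<R∸1 →
    rotation-notInjectiveOn h 2≤q q≤D (≤-trans (s≤s D<R∸1) (≤-reflexive (suc-pred R))) h<D h-inj (rowResidue-step p R)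
    where
    instance
      R≢0 : NonZero R
      R≢0 = >-nonZero (<-trans z<s 2≤R)
    D≤p : D ≤ p
    D≤p = <⇒≤ (<-trans D<R R<p)
    p∤R : ¬ p ∣ R
    p∤R p∣R = <⇒≱ R<p (∣⇒≤ p∣R)
    h : ℕ → ℕ
    h i = (i * p + (p ∸ 1)) % R
    h<D : ∀ {i} → i < D → h i < D
    h<D {i} i<D with detNonzero-binomial⇒row {e = E} D≤p det≢0 i<D
    ... | j , a , j<D , _ , row≡ =
      subst (_< D) (sym (multipleInRow⇒rowResidue {i = i} a (<⇒≤ D<R) D≤p j<D row≡))
            (≤-<-trans (m∸n≤m (pred D) j) (≤-reflexive (suc-pred D {{>-nonZero 1≤D}})))
    h-inj : ∀ {i i′} → i < D → i′ < D → h i ≡ h i′ → i ≡ i′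
    h-inj {i} {i′} i<D i′<D hᵢ≡hᵢ′ with <-cmp i i′
    ... | tri< i<i′ _ _ = contradiction hᵢ≡hᵢ′ (rowResidue-distinct p∤R i<i′ (<-trans i′<D D<R))
    ... | tri≈ _ i≡i′ _ = i≡i′
    ... | tri> _ _ i′<i = contradiction (sym hᵢ≡hᵢ′) (rowResidue-distinct p∤R i′<i (<-trans i<D D<R))
    2≤q : 2 ≤ p % R
    2≤q = 2≤p%R 2≤R R<p R∤p∸1
    q≤D : p % R ≤ D
    q≤D = subst (_≤ D) (suc-pred (p % R) {{≢-nonZero p%R≢0}}) (subst (_< D) ([m∸1]%n≡m%n∸1 p R p%R≢0) (h<D 1≤D))
      where
      p%R≢0 : p % R ≢ 0
      p%R≢0 = m<n⇒n≢0 2≤q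

  partIII : ∀ r e d →
      (InU p (r , e , d) × (+ 2) ℤ.≤ r × r ℤ.≤ + p ℤ.- ℤ.1ℤ × ¬ (r ℤD.∣ (+ p ℤ.- ℤ.1ℤ)) × detNZ p binomial (r , e , d))
    ⇔ (InB p (r , e , d) × (+ 2) ℤ.≤ r × r ℤ.≤ + p ℤ.- ℤ.1ℤ × ¬ (r ℤD.∣ (+ p ℤ.- ℤ.1ℤ)))
  partIII r e d = mk⇔ to from
    where
    R<p : ∀ {R} → + R ℤ.≤ + p ℤ.- ℤ.1ℤ → R < p
    R<p R≤p-1 = ≤p∸1⇒<p (ℤP.drop‿+≤+ (subst (_ ℤ.≤_) +p-1≡+[p∸1] R≤p-1))
    R∤p∸1 : ∀ {R} → ¬ (+ R ℤD.∣ (+ p ℤ.- ℤ.1ℤ)) → ¬ R ∣ p ∸ 1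
    R∤p∸1 R∤p-1 R∣p∸1 = R∤p-1 (subst (λ x → _ ∣ ∣ x ∣) (sym +p-1≡+[p∸1]) R∣p∸1)
    to : InU p (r , e , d) × (+ 2) ℤ.≤ r × r ℤ.≤ + p ℤ.- ℤ.1ℤ × ¬ (r ℤD.∣ (+ p ℤ.- ℤ.1ℤ)) × detNZ p binomial (r , e , d) →
         InB p (r , e , d) × (+ 2) ℤ.≤ r × r ℤ.≤ + p ℤ.- ℤ.1ℤ × ¬ (r ℤD.∣ (+ p ℤ.- ℤ.1ℤ))
    to (u , 2≤R , R≤p-1 , R∤p-1 , det≢0) with InU-nonneg u
    ... | R , E , D , refl , refl , refl = Equivalence.from (InB⇔InBℕ R E D) bℕ , 2≤R , R≤p-1 , R∤p-1
      where
      uℕ : InUℕ p R E D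
      uℕ = Equivalence.to (InU⇔InUℕ R E D) u
      bℕ : InBℕ p R E D
      bℕ with m≤n⇒m<n∨m≡n (InUℕ⇒D≤R uℕ)
      ... | inj₂ D≡R = inj₁ (InUℕ∧D≡R⇒InB₊ℕ uℕ D≡R)
      ... | inj₁ D<R = inj₂ (inj₁ (InUℕ∧D≡R∸1⇒InB₀ℕ uℕ D≡R∸1 (R∤p∸1 R∤p-1)))
        where
        D≡R∸1 : D ≡ pred R
        D≡R∸1 = ≤-antisym (<⇒≤pred D<R)
          (binomial-R<p⇒R∸1≤D {E = E} (InUℕ.2≤R uℕ) (R<p R≤p-1) (R∤p∸1 R∤p-1) (InUℕ.1≤D uℕ) D<R det≢0)
    from : InB p (r , e , d) × (+ 2) ℤ.≤ r × r ℤ.≤ + p ℤ.- ℤ.1ℤ × ¬ (r ℤD.∣ (+ p ℤ.- ℤ.1ℤ)) →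
           InU p (r , e , d) × (+ 2) ℤ.≤ r × r ℤ.≤ + p ℤ.- ℤ.1ℤ × ¬ (r ℤD.∣ (+ p ℤ.- ℤ.1ℤ)) × detNZ p binomial (r , e , d)
    from (b , 2≤R , R≤p-1 , R∤p-1) with InB-nonneg b
    ... | R , E , D , refl , refl , refl =
      Equivalence.from (InU⇔InUℕ R E D) (InB₊ℕ⊎InB₀ℕ⇒InUℕ b₊⊎b₀) , 2≤R , R≤p-1 , R∤p-1
      , InB₊ℕ⊎InB₀ℕ⇒binomial-detNonzero p∤R b₊⊎b₀
      where
      b₊⊎b₀ : InB₊ℕ p R E D ⊎ InB₀ℕ p R E D
      b₊⊎b₀ = R∤p∸1⇒InB₊ℕ⊎InB₀ℕ (R∤p∸1 R∤p-1) (Equivalence.to (InB⇔InBℕ R E D) b)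
      p∤R : ¬ p ∣ R
      p∤R p∣R = <⇒≱ (R<p R≤p-1) (∣⇒≤ {{>-nonZero (<-trans z<s (ℤP.drop‿+≤+ 2≤R))}} p∣R)

lemma6 : Lemma6
lemma6 p pp = partI pp , partII pp , partIII pp
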